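{- Let $q\ge 16$ be a prime power. There is no set $S$ of $q+1$ points in $\mathrm{PG}(2,q)$ with $3q-5\le u_0(S)\le 4q-17$.
   Context: $\mathrm{PG}(2,q)$ is the projective plane over $\mathbb{F}_q$. For a set $S$ of $q+1$ points, $u_0(S)$ (the non-hitting index) is the number of lines of $\mathrm{PG}(2,q)$ containing no point of $S$. -}

module Defs where

open import Level using (0ℓ)
open import Data.Nat using (ℕ)
open import Data.Fin using (Fin)
open import Data.Product using (_×_; _,_; ∃)
open import Data.Sum using (_⊎_)
open import Data.List using (List; length; filter; allFin; cartesianProduct; map; concatMap)
open import Data.List.Relation.Unary.All using (All)
open import Data.List.Relation.Unary.All using () renaming (all? to allDec)
open import Relation.Nullary using (¬_; Dec)
open import Relation.Nullary.Decidable using (_×-dec_; _⊎-dec_; ¬?)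
open import Relation.Binary using (Decidable)
open import Relation.Binary.PropositionalEquality using (_≡_)
open import Algebra.Bundles using (CommutativeRing)

record FiniteField (q : ℕ) : Set₁ where
  field
    commRing : CommutativeRing 0ℓ 0ℓ
  open CommutativeRing commRing public
  field
    0≉1       : ¬ (0# ≈ 1#)
    inverse   : ∀ x → ¬ (x ≈ 0#) → ∃ λ y → x * y ≈ 1#
    _≟_       : Decidable _≈_
    enum      : Fin q → Carrier
    enum-inj  : ∀ i j → enum i ≈ enum j → i ≡ j
    enum-surj : ∀ x → ∃ λ i → enum i ≈ x

-- Vectors of F_q^3, represented by the indices of their coordinates.
Triple : ℕ → Set
Triple q = Fin q × Fin q × Fin q

allTriples : (q : ℕ) → List (Triple q)
allTriples q = concatMap (λ a → concatMap (λ b → map (λ c → (a , b , c)) (allFin q)) (allFin q)) (allFin q)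

module PG2 {q : ℕ} (K : FiniteField q) where
  open FiniteField K

  -- Canonical representative of a point / line of PG(2,q): a nonzero vector
  -- whose first nonzero coordinate equals 1.
  Normalized : Triple q → Set
  Normalized (a , b , c) =
    (enum a ≈ 1#) ⊎ ((enum a ≈ 0#) × (enum b ≈ 1#)) ⊎ ((enum a ≈ 0#) × (enum b ≈ 0#) × (enum c ≈ 1#))

  normalized? : (t : Triple q) → Dec (Normalized t)
  normalized? (a , b , c) =
    (enum a ≟ 1#) ⊎-dec ((enum a ≟ 0#) ×-dec (enum b ≟ 1#)) ⊎-dec ((enum a ≟ 0#) ×-dec (enum b ≟ 0#) ×-dec (enum c ≟ 1#))

  IsPoint : Triple q → Set
  IsPoint = Normalized

  IsLine : Triple q → Set
  IsLine = Normalized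

  Incident : Triple q → Triple q → Set
  Incident (x , y , z) (a , b , c) = (enum a * enum x + enum b * enum y + enum c * enum z) ≈ 0#

  incident? : (p l : Triple q) → Dec (Incident p l)
  incident? (x , y , z) (a , b , c) = (enum a * enum x + enum b * enum y + enum c * enum z) ≟ 0#

  MissesAll : List (Triple q) → Triple q → Set
  MissesAll S l = IsLine l × All (λ p → ¬ Incident p l) S

  missesAll? : (S : List (Triple q)) → (l : Triple q) → Dec (MissesAll S l)
  missesAll? S l = normalized? l ×-dec allDec (λ p → ¬? (incident? p l)) S

  u₀ : List (Triple q) → ℕ
  u₀ S = length (filter (missesAll? S) (allTriples q))

-- Write k(l) for the number of points of S on a line l and t = u₀(S). Counting incidences
-- and pairs of points of S gives, over the q² + q + 1 lines, Σ 1 = q² + q + 1,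
-- Σ k = (q + 1)² and Σ k² = (q + 1)(2q + 1).
-- * If every k(l) ≤ 4, then 4 + k² ≤ 5k + 4[k = 0] on every line, and summing gives
--   q² ≤ 3q + 4t, so t > 4q - 17 once q ≥ 16.
-- * Otherwise some line ℓ has k = k(ℓ) ≥ 5. If k ≥ q - 2, summing 3k + 2[k = 0] ≤ 2 + k²,
--   which has slack (k - 1)(k - 2) ≥ (q - 3)(q - 4) at ℓ, gives t ≤ 3q - 6.
-- * If 5 ≤ k ≤ q - 3, the m = q + 1 - k points of ℓ outside S each lie on q further lines,
--   at most m of which meet S, and an external line meets ℓ in only one point;
--   so t ≥ m(q - m) ≥ 4(q - 4) > 4q - 17.
-- The incidence counts come from coordinates: the line through two points is their
-- normalized cross product, and it is the only one.

module Submission where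

open import Level using (Level)
open import Algebra.Bundles using (CommutativeRing)
open import Data.Nat using (ℕ)
open import Data.List using (List)
open import Data.List.Relation.Unary.All using (All)
open import Data.List.Relation.Unary.Unique.Propositional using (Unique)
open import Defs

-- The ring solver with integer coefficients, so that it can cancel x - x in an
-- arbitrary commutative ring.
module IntegerRingSolver {c ℓ : Level} (R : CommutativeRing c ℓ) where
  open import Data.Nat as ℕ using (ℕ; zero; suc)
  import Data.Nat.Properties as ℕ
  open import Data.Integer as ℤ using (ℤ; +_; -[1+_]; _⊖_)
  import Data.Integer.Properties as ℤ
  open import Data.Sign as Sign using (Sign)
  open import Data.Maybe using (Maybe; just; nothing)
  open import Relation.Nullary using (yes; no)
  open import Relation.Binary.PropositionalEquality as ≡ using (_≡_)
  open import Function using (id)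
  open CommutativeRing R
  open import Algebra.Properties.Semiring.Mult semiring using (_×_; ×-homo-+; ×1-homo-*)
  open import Algebra.Properties.Ring ring using (-‿distribˡ-*; -‿distribʳ-*)
  open import Algebra.Properties.AbelianGroup +-abelianGroup using (⁻¹-involutive; ε⁻¹≈ε; ⁻¹-∙-comm)
  open import Algebra.Properties.CommutativeSemigroup +-commutativeSemigroup using (interchange)
  open import Algebra.Solver.Ring.AlmostCommutativeRing using (_-Raw-AlmostCommutative⟶_; fromCommutativeRing)
  open import Relation.Binary.Reasoning.Setoid setoid

  -- Unlike n × 1#, this sends 1 to 1# definitionally, so a constant 1 in a solved equation is 1#.
  fromℕ : ℕ → Carrier
  fromℕ 0 = 0#
  fromℕ 1 = 1#
  fromℕ (suc n@(suc _)) = 1# + fromℕ n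

  fromℕ≈× : ∀ n → fromℕ n ≈ n × 1#
  fromℕ≈× 0 = refl
  fromℕ≈× 1 = sym (+-identityʳ 1#)
  fromℕ≈× (suc n@(suc _)) = +-congˡ (fromℕ≈× n)

  fromℕ-+ : ∀ m n → fromℕ (m ℕ.+ n) ≈ fromℕ m + fromℕ n
  fromℕ-+ m n = begin
    fromℕ (m ℕ.+ n)    ≈⟨ fromℕ≈× (m ℕ.+ n) ⟩
    (m ℕ.+ n) × 1#     ≈⟨ ×-homo-+ 1# m n ⟩
    m × 1# + n × 1#    ≈⟨ +-cong (fromℕ≈× m) (fromℕ≈× n) ⟨
    fromℕ m + fromℕ n  ∎

  fromℕ-* : ∀ m n → fromℕ (m ℕ.* n) ≈ fromℕ m * fromℕ n
  fromℕ-* m n = begin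
    fromℕ (m ℕ.* n)    ≈⟨ fromℕ≈× (m ℕ.* n) ⟩
    (m ℕ.* n) × 1#     ≈⟨ ×1-homo-* m n ⟩
    m × 1# * n × 1#    ≈⟨ *-cong (fromℕ≈× m) (fromℕ≈× n) ⟨
    fromℕ m * fromℕ n  ∎

  fromℤ : ℤ → Carrier
  fromℤ (+ n) = fromℕ n
  fromℤ -[1+ n ] = - fromℕ (suc n)

  fromℤ-‿ : ∀ i → fromℤ (ℤ.- i) ≈ - fromℤ i
  fromℤ-‿ (+ zero) = sym ε⁻¹≈ε
  fromℤ-‿ (+ suc n) = refl
  fromℤ-‿ -[1+ n ] = sym (⁻¹-involutive _)

  fromℤ-⊖ : ∀ m n → fromℤ (m ⊖ n) ≈ fromℕ m - fromℕ n
  fromℤ-⊖ m zero = begin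
    fromℤ (m ⊖ 0)  ≡⟨ ≡.cong fromℤ (ℤ.⊖-≥ {m} ℕ.z≤n) ⟩
    fromℕ m        ≈⟨ +-identityʳ _ ⟨
    fromℕ m + 0#   ≈⟨ +-congˡ ε⁻¹≈ε ⟨
    fromℕ m - 0#   ∎
  fromℤ-⊖ zero (suc n) = begin
    fromℤ (0 ⊖ suc n)   ≡⟨ ≡.cong fromℤ (ℤ.⊖-≤ {0} {suc n} ℕ.z≤n) ⟩
    - fromℕ (suc n)     ≈⟨ +-identityˡ _ ⟨
    0# - fromℕ (suc n)  ∎
  fromℤ-⊖ (suc m) (suc n) = begin
    fromℤ (suc m ⊖ suc n)              ≡⟨ ≡.cong fromℤ (ℤ.[1+m]⊖[1+n]≡m⊖n m n) ⟩
    fromℤ (m ⊖ n)                      ≈⟨ fromℤ-⊖ m n ⟩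
    fromℕ m - fromℕ n                  ≈⟨ +-identityˡ _ ⟨
    0# + (fromℕ m - fromℕ n)           ≈⟨ +-congʳ (-‿inverseʳ 1#) ⟨
    (1# - 1#) + (fromℕ m - fromℕ n)    ≈⟨ interchange 1# (- 1#) (fromℕ m) (- fromℕ n) ⟩
    (1# + fromℕ m) + (- 1# - fromℕ n)  ≈⟨ +-congˡ (⁻¹-∙-comm 1# (fromℕ n)) ⟩
    (1# + fromℕ m) - (1# + fromℕ n)    ≈⟨ +-cong (fromℕ-+ 1 m) (-‿cong (fromℕ-+ 1 n)) ⟨
    fromℕ (suc m) - fromℕ (suc n)      ∎

  fromℤ-+ : ∀ i j → fromℤ (i ℤ.+ j) ≈ fromℤ i + fromℤ j
  fromℤ-+ (+ m) (+ n) = fromℕ-+ m n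
  fromℤ-+ (+ m) -[1+ n ] = fromℤ-⊖ m (suc n)
  fromℤ-+ -[1+ m ] (+ n) = trans (fromℤ-⊖ n (suc m)) (+-comm _ _)
  fromℤ-+ -[1+ m ] -[1+ n ] = begin
    - fromℕ (suc (suc (m ℕ.+ n)))      ≡⟨ ≡.cong (λ k → - fromℕ k) (ℕ.+-suc (suc m) n) ⟨
    - fromℕ (suc m ℕ.+ suc n)          ≈⟨ -‿cong (fromℕ-+ (suc m) (suc n)) ⟩
    - (fromℕ (suc m) + fromℕ (suc n))  ≈⟨ ⁻¹-∙-comm _ _ ⟨
    - fromℕ (suc m) - fromℕ (suc n)    ∎

  private
    signed : Sign → Carrier → Carrier
    signed Sign.+ x = x
    signed Sign.- x = - x

    signed-cong : ∀ s {x y} → x ≈ y → signed s x ≈ signed s y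
    signed-cong Sign.+ = id
    signed-cong Sign.- = -‿cong

    signed-* : ∀ s t x y → signed (s Sign.* t) (x * y) ≈ signed s x * signed t y
    signed-* Sign.+ Sign.+ x y = refl
    signed-* Sign.+ Sign.- x y = -‿distribʳ-* x y
    signed-* Sign.- Sign.+ x y = -‿distribˡ-* x y
    signed-* Sign.- Sign.- x y = begin
      x * y        ≈⟨ ⁻¹-involutive _ ⟨
      - - (x * y)  ≈⟨ -‿cong (-‿distribˡ-* x y) ⟩
      - (- x * y)  ≈⟨ -‿distribʳ-* (- x) y ⟩
      - x * - y    ∎

    fromℤ-◃ : ∀ s n → fromℤ (s ℤ.◃ n) ≈ signed s (fromℕ n)
    fromℤ-◃ Sign.+ zero = refl
    fromℤ-◃ Sign.- zero = sym ε⁻¹≈ε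
    fromℤ-◃ Sign.+ (suc n) = refl
    fromℤ-◃ Sign.- (suc n) = refl

    fromℤ-sign-abs : ∀ i → fromℤ i ≈ signed (ℤ.sign i) (fromℕ ℤ.∣ i ∣)
    fromℤ-sign-abs (+ n) = refl
    fromℤ-sign-abs -[1+ n ] = refl

  fromℤ-* : ∀ i j → fromℤ (i ℤ.* j) ≈ fromℤ i * fromℤ j
  fromℤ-* i j = begin
    fromℤ (s ℤ.◃ (∣i∣ ℕ.* ∣j∣))                                    ≈⟨ fromℤ-◃ s (∣i∣ ℕ.* ∣j∣) ⟩
    signed s (fromℕ (∣i∣ ℕ.* ∣j∣))                                 ≈⟨ signed-cong s (fromℕ-* ∣i∣ ∣j∣) ⟩
    signed s (fromℕ ∣i∣ * fromℕ ∣j∣)                               ≈⟨ signed-* (ℤ.sign i) (ℤ.sign j) _ _ ⟩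
    signed (ℤ.sign i) (fromℕ ∣i∣) * signed (ℤ.sign j) (fromℕ ∣j∣)  ≈⟨ *-cong (fromℤ-sign-abs i) (fromℤ-sign-abs j) ⟨
    fromℤ i * fromℤ j                                              ∎
    where
    s = ℤ.sign i Sign.* ℤ.sign j
    ∣i∣ = ℤ.∣ i ∣
    ∣j∣ = ℤ.∣ j ∣

  ℤ-homomorphism : ℤ.+-*-rawRing -Raw-AlmostCommutative⟶ fromCommutativeRing R
  ℤ-homomorphism = record
    { ⟦_⟧    = fromℤ
    ; +-homo = fromℤ-+
    ; *-homo = fromℤ-*
    ; -‿homo = fromℤ-‿
    ; 0-homo = refl
    ; 1-homo = refl
    }

  private
    ≡⇒fromℤ≈ : ∀ i j → Maybe (fromℤ i ≈ fromℤ j)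
    ≡⇒fromℤ≈ i j with i ℤ.≟ j
    ... | yes ≡.refl = just refl
    ... | no _ = nothing

  open import Algebra.Solver.Ring ℤ.+-*-rawRing (fromCommutativeRing R) ℤ-homomorphism ≡⇒fromℤ≈ public

module Counting where
  open import Data.Nat using (ℕ; suc; _+_; _*_; _≤_; z≤n; s≤s)
  open import Data.Nat.Properties
  open import Data.Product using (_,_)
  open import Data.List using (List; []; _∷_; length; filter; concatMap)
  open import Data.List.Membership.Propositional using (_∈_; _∉_)
  open import Data.List.Relation.Unary.Any using (here; there)
  open import Data.List.Relation.Unary.All as All using (All; []; _∷_)
  import Data.List.Relation.Unary.All.Properties as All
  open import Data.List.Relation.Unary.AllPairs as AllPairs using (_∷_)
  import Data.List.Relation.Unary.AllPairs.Properties as AllPairs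
  open import Data.List.Relation.Unary.Unique.Propositional using (Unique)
  open import Data.List.Relation.Unary.Unique.Propositional.Properties using (concat⁺)
  open import Data.Empty using (⊥-elim)
  open import Relation.Nullary using (¬_; Dec; yes; no)
  open import Relation.Nullary.Decidable using (_×-dec_; ¬?)
  open import Relation.Unary using (Pred; Decidable)
  open import Relation.Binary.Definitions using (DecidableEquality)
  open import Relation.Binary.PropositionalEquality using (_≡_; refl; sym; trans; cong; cong₂; module ≡-Reasoning)
  open import Algebra.Properties.CommutativeSemigroup +-commutativeSemigroup using (interchange; xy∙z≈zy∙x)

  private
    variable
      a b p : Level
      A : Set a
      B : Set b
      P Q : Set p

  𝟙 : Dec P → ℕ
  𝟙 (yes _) = 1
  𝟙 (no _) = 0

  𝟙-yes : (d : Dec P) → P → 𝟙 d ≡ 1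
  𝟙-yes (yes _) _ = refl
  𝟙-yes (no ¬p) p = ⊥-elim (¬p p)

  𝟙-no : (d : Dec P) → ¬ P → 𝟙 d ≡ 0
  𝟙-no (yes p) ¬p = ⊥-elim (¬p p)
  𝟙-no (no _) _ = refl

  𝟙-cong : (d : Dec P) (e : Dec Q) → (P → Q) → (Q → P) → 𝟙 d ≡ 𝟙 e
  𝟙-cong d (yes q) _ g = 𝟙-yes d (g q)
  𝟙-cong d (no ¬q) f _ = 𝟙-no d (λ p → ¬q (f p))

  𝟙-× : (d : Dec P) (e : Dec Q) → 𝟙 (d ×-dec e) ≡ 𝟙 d * 𝟙 e
  𝟙-× (yes _) (yes _) = refl
  𝟙-× (yes _) (no _) = refl
  𝟙-× (no _) _ = refl

  𝟙-¬ : (d : Dec P) → 𝟙 d + 𝟙 (¬? d) ≡ 1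
  𝟙-¬ (yes _) = refl
  𝟙-¬ (no _) = refl

  𝟙-idem : (d : Dec P) → 𝟙 d * 𝟙 d ≡ 𝟙 d
  𝟙-idem (yes _) = refl
  𝟙-idem (no _) = refl

  ∑ : List A → (A → ℕ) → ℕ
  ∑ [] f = 0
  ∑ (x ∷ xs) f = f x + ∑ xs f

  ∑-cong : ∀ xs {f g : A → ℕ} → (∀ {x} → x ∈ xs → f x ≡ g x) → ∑ xs f ≡ ∑ xs g
  ∑-cong [] eq = refl
  ∑-cong (x ∷ xs) eq = cong₂ _+_ (eq (here refl)) (∑-cong xs (λ x∈ → eq (there x∈)))

  ∑-mono-≤ : ∀ xs {f g : A → ℕ} → (∀ {x} → x ∈ xs → f x ≤ g x) → ∑ xs f ≤ ∑ xs g
  ∑-mono-≤ [] le = z≤n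
  ∑-mono-≤ (x ∷ xs) le = +-mono-≤ (le (here refl)) (∑-mono-≤ xs (λ x∈ → le (there x∈)))

  ∑-distrib-+ : ∀ xs (f g : A → ℕ) → ∑ xs (λ x → f x + g x) ≡ ∑ xs f + ∑ xs g
  ∑-distrib-+ [] f g = refl
  ∑-distrib-+ (x ∷ xs) f g = begin
    f x + g x + ∑ xs (λ x → f x + g x)  ≡⟨ cong (f x + g x +_) (∑-distrib-+ xs f g) ⟩
    f x + g x + (∑ xs f + ∑ xs g)       ≡⟨ interchange (f x) (g x) (∑ xs f) (∑ xs g) ⟩
    f x + ∑ xs f + (g x + ∑ xs g)       ∎
    where open ≡-Reasoning

  ∑-*ˡ : ∀ xs c (f : A → ℕ) → ∑ xs (λ x → c * f x) ≡ c * ∑ xs f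
  ∑-*ˡ [] c f = sym (*-zeroʳ c)
  ∑-*ˡ (x ∷ xs) c f = trans (cong (c * f x +_) (∑-*ˡ xs c f)) (sym (*-distribˡ-+ c (f x) (∑ xs f)))

  ∑-*ʳ : ∀ xs c (f : A → ℕ) → ∑ xs (λ x → f x * c) ≡ ∑ xs f * c
  ∑-*ʳ [] c f = refl
  ∑-*ʳ (x ∷ xs) c f = trans (cong (f x * c +_) (∑-*ʳ xs c f)) (sym (*-distribʳ-+ c (f x) (∑ xs f)))

  ∑-const : ∀ (xs : List A) c → ∑ xs (λ _ → c) ≡ c * length xs
  ∑-const [] c = sym (*-zeroʳ c)
  ∑-const (x ∷ xs) c = trans (cong (c +_) (∑-const xs c)) (sym (*-suc c (length xs)))

  ∑-swap : ∀ (xs : List A) (ys : List B) (f : A → B → ℕ) →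
           ∑ xs (λ x → ∑ ys (f x)) ≡ ∑ ys (λ y → ∑ xs (λ x → f x y))
  ∑-swap [] ys f = sym (trans (∑-const ys 0) (*-zeroˡ (length ys)))
  ∑-swap (x ∷ xs) ys f = trans (cong (∑ ys (f x) +_) (∑-swap xs ys f))
                               (sym (∑-distrib-+ ys (f x) (λ y → ∑ xs (λ x′ → f x′ y))))

  ∑-mono-≤-with-gap : ∀ xs {f g : A → ℕ} → (∀ {x} → x ∈ xs → f x ≤ g x) →
                      ∀ {y} → y ∈ xs → ∑ xs f + g y ≤ ∑ xs g + f y
  ∑-mono-≤-with-gap (x ∷ xs) {f} {g} le (here refl) = begin
    f x + ∑ xs f + g x  ≡⟨ xy∙z≈zy∙x (f x) (∑ xs f) (g x) ⟩
    g x + ∑ xs f + f x  ≤⟨ +-monoˡ-≤ (f x) (+-monoʳ-≤ (g x) (∑-mono-≤ xs (λ x∈ → le (there x∈)))) ⟩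
    g x + ∑ xs g + f x  ∎
    where open ≤-Reasoning
  ∑-mono-≤-with-gap (x ∷ xs) {f} {g} le {y} (there y∈) = begin
    f x + ∑ xs f + g y    ≡⟨ +-assoc (f x) _ _ ⟩
    f x + (∑ xs f + g y)  ≤⟨ +-mono-≤ (le (here refl)) (∑-mono-≤-with-gap xs (λ x∈ → le (there x∈)) y∈) ⟩
    g x + (∑ xs g + f y)  ≡⟨ +-assoc (g x) _ _ ⟨
    g x + ∑ xs g + f y    ∎
    where open ≤-Reasoning

  module _ {P : Pred A p} (P? : Decidable P) where

    length-filter≡∑𝟙 : ∀ xs → length (filter P? xs) ≡ ∑ xs (λ x → 𝟙 (P? x))
    length-filter≡∑𝟙 [] = refl
    length-filter≡∑𝟙 (x ∷ xs) with P? x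
    ... | yes _ = cong suc (length-filter≡∑𝟙 xs)
    ... | no _ = length-filter≡∑𝟙 xs

    ∑-filter : ∀ xs (f : A → ℕ) → ∑ (filter P? xs) f ≡ ∑ xs (λ x → 𝟙 (P? x) * f x)
    ∑-filter [] f = refl
    ∑-filter (x ∷ xs) f with P? x
    ... | yes _ = cong₂ _+_ (sym (+-identityʳ (f x))) (∑-filter xs f)
    ... | no _ = ∑-filter xs f

    ∑𝟙-none : ∀ {xs} → All (λ x → ¬ P x) xs → ∑ xs (λ x → 𝟙 (P? x)) ≡ 0
    ∑𝟙-none [] = refl
    ∑𝟙-none {x ∷ _} (¬Px ∷ ¬Pxs) = cong₂ _+_ (𝟙-no (P? x) ¬Px) (∑𝟙-none ¬Pxs)

    ∑𝟙-some : ∀ {xs} → ¬ All (λ x → ¬ P x) xs → 1 ≤ ∑ xs (λ x → 𝟙 (P? x))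
    ∑𝟙-some {[]} ¬none = ⊥-elim (¬none [])
    ∑𝟙-some {x ∷ xs} ¬none with P? x
    ... | yes _ = s≤s z≤n
    ... | no ¬Px = ∑𝟙-some (λ ¬Pxs → ¬none (¬Px ∷ ¬Pxs))

  module _ (_≟_ : DecidableEquality A) where
    open import Data.List.Membership.DecPropositional _≟_ using (_∈?_)

    ∑-absent : ∀ {ys x} (f : A → ℕ) → x ∉ ys → ∑ ys (λ y → 𝟙 (y ≟ x) * f y) ≡ 0
    ∑-absent {[]} f x∉ = refl
    ∑-absent {y ∷ ys} {x} f x∉ =
      cong₂ _+_ (cong (_* f y) (𝟙-no (y ≟ x) (λ y≡x → x∉ (here (sym y≡x))))) (∑-absent f (λ x∈ → x∉ (there x∈)))

    ∑-δ : ∀ {ys x} (f : A → ℕ) → Unique ys → x ∈ ys → ∑ ys (λ y → 𝟙 (y ≟ x) * f y) ≡ f x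
    ∑-δ {y ∷ ys} f (y∉ys ∷ _) (here refl) = begin
      𝟙 (y ≟ y) * f y + ∑ ys (λ z → 𝟙 (z ≟ y) * f z)  ≡⟨ cong₂ _+_ (cong (_* f y) (𝟙-yes (y ≟ y) refl)) (∑-absent f (All.All¬⇒¬Any y∉ys)) ⟩
      1 * f y + 0                                     ≡⟨ +-identityʳ _ ⟩
      1 * f y                                         ≡⟨ *-identityˡ _ ⟩
      f y                                             ∎
      where open ≡-Reasoning
    ∑-δ {y ∷ ys} {x} f (y∉ys ∷ u) (there x∈) =
      cong₂ _+_ (cong (_* f y) (𝟙-no (y ≟ x) (λ { refl → All.All¬⇒¬Any y∉ys x∈ }))) (∑-δ f u x∈)

    ∑-δ-split : ∀ {ys x} (f : A → ℕ) → Unique ys → x ∈ ys →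
                ∑ ys f ≡ ∑ ys (λ y → 𝟙 (¬? (y ≟ x)) * f y) + f x
    ∑-δ-split {ys} {x} f u x∈ = begin
      ∑ ys f                                                            ≡⟨ ∑-cong ys (λ {y} _ → split y) ⟩
      ∑ ys (λ y → 𝟙 (y ≟ x) * f y + 𝟙 (¬? (y ≟ x)) * f y)               ≡⟨ ∑-distrib-+ ys _ _ ⟩
      ∑ ys (λ y → 𝟙 (y ≟ x) * f y) + ∑ ys (λ y → 𝟙 (¬? (y ≟ x)) * f y)  ≡⟨ cong (_+ ∑ ys (λ y → 𝟙 (¬? (y ≟ x)) * f y)) (∑-δ f u x∈) ⟩
      f x + ∑ ys (λ y → 𝟙 (¬? (y ≟ x)) * f y)                           ≡⟨ +-comm (f x) _ ⟩
      ∑ ys (λ y → 𝟙 (¬? (y ≟ x)) * f y) + f x                           ∎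
      where
      open ≡-Reasoning
      split : ∀ y → f y ≡ 𝟙 (y ≟ x) * f y + 𝟙 (¬? (y ≟ x)) * f y
      split y = begin
        f y                                     ≡⟨ *-identityˡ (f y) ⟨
        1 * f y                                 ≡⟨ cong (_* f y) (𝟙-¬ (y ≟ x)) ⟨
        (𝟙 (y ≟ x) + 𝟙 (¬? (y ≟ x))) * f y      ≡⟨ *-distribʳ-+ (f y) (𝟙 (y ≟ x)) _ ⟩
        𝟙 (y ≟ x) * f y + 𝟙 (¬? (y ≟ x)) * f y  ∎

    𝟙-∈∷ : ∀ {x xs} y → x ∉ xs → 𝟙 (y ∈? x ∷ xs) ≡ 𝟙 (y ≟ x) + 𝟙 (y ∈? xs)
    𝟙-∈∷ {x} {xs} y x∉ with y ≟ x | y ∈? xs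
    ... | yes refl | yes y∈ = ⊥-elim (x∉ y∈)
    ... | yes refl | no _ = refl
    ... | no y≢x | d = 𝟙-cong _ d (λ { (here y≡x) → ⊥-elim (y≢x y≡x) ; (there y∈) → y∈ }) there

    ∑-∈ : ∀ {ys xs} (f : A → ℕ) → Unique ys → Unique xs → (∀ {x} → x ∈ xs → x ∈ ys) →
          ∑ ys (λ y → 𝟙 (y ∈? xs) * f y) ≡ ∑ xs f
    ∑-∈ {ys} {[]} f _ _ _ = trans (∑-const ys 0) (*-zeroˡ (length ys))
    ∑-∈ {ys} {x ∷ xs} f uy (x∉xs ∷ ux) xs⊆ys = begin
      ∑ ys (λ y → 𝟙 (y ∈? x ∷ xs) * f y)                             ≡⟨ ∑-cong ys (λ {y} _ → cong (_* f y) (𝟙-∈∷ y (All.All¬⇒¬Any x∉xs))) ⟩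
      ∑ ys (λ y → (𝟙 (y ≟ x) + 𝟙 (y ∈? xs)) * f y)                   ≡⟨ ∑-cong ys (λ {y} _ → *-distribʳ-+ (f y) (𝟙 (y ≟ x)) _) ⟩
      ∑ ys (λ y → 𝟙 (y ≟ x) * f y + 𝟙 (y ∈? xs) * f y)               ≡⟨ ∑-distrib-+ ys _ _ ⟩
      ∑ ys (λ y → 𝟙 (y ≟ x) * f y) + ∑ ys (λ y → 𝟙 (y ∈? xs) * f y)  ≡⟨ cong₂ _+_ (∑-δ f uy (xs⊆ys (here refl))) (∑-∈ f uy ux (λ x∈ → xs⊆ys (there x∈))) ⟩
      f x + ∑ xs f                                                   ∎
      where open ≡-Reasoning

  Unique-concatMap : ∀ {f : A → List B} {xs} (key : B → A) →
                     Unique xs → (∀ x → Unique (f x)) → (∀ {x y} → y ∈ f x → key y ≡ x) →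
                     Unique (concatMap f xs)
  Unique-concatMap key xs-unique f-unique key-f =
    concat⁺ (All.map⁺ (All.universal f-unique _))
            (AllPairs.map⁺ (AllPairs.map (λ x≢x′ {_} (y∈fx , y∈fx′) → x≢x′ (trans (sym (key-f y∈fx)) (key-f y∈fx′))) xs-unique))

module Coordinates {q : ℕ} (K : FiniteField q) where
  open import Data.Nat using (ℕ)
  open import Data.Fin using (Fin)
  open import Data.Integer using (+_)
  open import Data.Product using (_×_; _,_; proj₁; proj₂; ∃)
  open import Data.Sum using (inj₁; inj₂)
  open import Data.Empty using (⊥; ⊥-elim)
  open import Relation.Nullary using (¬_; yes; no)
  open import Relation.Binary.PropositionalEquality as ≡ using (_≡_; _≢_)
  open FiniteField K
  open PG2 K
  open IntegerRingSolver commRing using (solve; _:=_; _:+_; _:*_; _:-_; con)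
  open import Algebra.Properties.AbelianGroup +-abelianGroup using (x∙y⁻¹≈ε⇒x≈y)
  open import Relation.Binary.Reasoning.Setoid setoid

  K³ : Set
  K³ = Carrier × Carrier × Carrier

  coords : Triple q → K³
  coords (a , b , c) = enum a , enum b , enum c

  infix 4 _≈³_
  _≈³_ : K³ → K³ → Set
  (x₁ , x₂ , x₃) ≈³ (y₁ , y₂ , y₃) = x₁ ≈ y₁ × x₂ ≈ y₂ × x₃ ≈ y₃

  ≈³-trans : ∀ {x y z} → x ≈³ y → y ≈³ z → x ≈³ z
  ≈³-trans (e₁ , e₂ , e₃) (f₁ , f₂ , f₃) = trans e₁ f₁ , trans e₂ f₂ , trans e₃ f₃

  IsZero³ : K³ → Set
  IsZero³ x = x ≈³ (0# , 0# , 0#)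

  infixr 7 _·_
  _·_ : Carrier → K³ → K³
  k · (x₁ , x₂ , x₃) = k * x₁ , k * x₂ , k * x₃

  ·-congˡ : ∀ k {x y} → x ≈³ y → k · x ≈³ k · y
  ·-congˡ k (e₁ , e₂ , e₃) = *-congˡ e₁ , *-congˡ e₂ , *-congˡ e₃

  ·-assoc : ∀ k l x → k · l · x ≈³ (k * l) · x
  ·-assoc k l (x₁ , x₂ , x₃) = sym (*-assoc k l x₁) , sym (*-assoc k l x₂) , sym (*-assoc k l x₃)

  ·-identityˡ : ∀ {k} x → k ≈ 1# → k · x ≈³ x
  ·-identityˡ (x₁ , x₂ , x₃) k≈1 = unit x₁ , unit x₂ , unit x₃
    where unit = λ x → trans (*-congʳ k≈1) (*-identityˡ x)

  infix 8 _∙_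
  _∙_ : K³ → K³ → Carrier
  (x₁ , x₂ , x₃) ∙ (y₁ , y₂ , y₃) = x₁ * y₁ + x₂ * y₂ + x₃ * y₃

  infixr 8 _⨯_
  _⨯_ : K³ → K³ → K³
  (x₁ , x₂ , x₃) ⨯ (y₁ , y₂ , y₃) = x₂ * y₃ - x₃ * y₂ , x₃ * y₁ - x₁ * y₃ , x₁ * y₂ - x₂ * y₁

  ∙-congʳ : ∀ x {y y′} → y ≈³ y′ → x ∙ y ≈ x ∙ y′
  ∙-congʳ (x₁ , x₂ , x₃) (e₁ , e₂ , e₃) = +-cong (+-cong (*-congˡ e₁) (*-congˡ e₂)) (*-congˡ e₃)

  ∙-001 : ∀ x → x ∙ (0# , 0# , 1#) ≈ proj₂ (proj₂ x)
  ∙-001 (x₁ , x₂ , x₃) = solve 3 (λ x₁ x₂ x₃ → x₁ :* con (+ 0) :+ x₂ :* con (+ 0) :+ x₃ :* con (+ 1) := x₃) refl x₁ x₂ x₃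

  ∙-101 : ∀ x → x ∙ (1# , 0# , 1#) ≈ proj₁ x + proj₂ (proj₂ x)
  ∙-101 (x₁ , x₂ , x₃) = solve 3 (λ x₁ x₂ x₃ → x₁ :* con (+ 1) :+ x₂ :* con (+ 0) :+ x₃ :* con (+ 1) := x₁ :+ x₃) refl x₁ x₂ x₃

  ∙-011 : ∀ x → x ∙ (0# , 1# , 1#) ≈ proj₁ (proj₂ x) + proj₂ (proj₂ x)
  ∙-011 (x₁ , x₂ , x₃) = solve 3 (λ x₁ x₂ x₃ → x₁ :* con (+ 0) :+ x₂ :* con (+ 1) :+ x₃ :* con (+ 1) := x₂ :+ x₃) refl x₁ x₂ x₃

  ∙-comm : ∀ x y → x ∙ y ≈ y ∙ x
  ∙-comm (x₁ , x₂ , x₃) (y₁ , y₂ , y₃) =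
    solve 6 (λ x₁ x₂ x₃ y₁ y₂ y₃ → x₁ :* y₁ :+ x₂ :* y₂ :+ x₃ :* y₃ := y₁ :* x₁ :+ y₂ :* x₂ :+ y₃ :* x₃)
          refl x₁ x₂ x₃ y₁ y₂ y₃

  ∙-·ˡ : ∀ {x k y} z → x ≈³ k · y → x ∙ z ≈ k * (y ∙ z)
  ∙-·ˡ {x₁ , x₂ , x₃} {k} {y₁ , y₂ , y₃} (z₁ , z₂ , z₃) (e₁ , e₂ , e₃) = begin
    x₁ * z₁ + x₂ * z₂ + x₃ * z₃              ≈⟨ +-cong (+-cong (*-congʳ e₁) (*-congʳ e₂)) (*-congʳ e₃) ⟩
    k * y₁ * z₁ + k * y₂ * z₂ + k * y₃ * z₃  ≈⟨ factor k y₁ y₂ y₃ z₁ z₂ z₃ ⟩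
    k * (y₁ * z₁ + y₂ * z₂ + y₃ * z₃)        ∎
    where
    factor = solve 7 (λ k y₁ y₂ y₃ z₁ z₂ z₃ →
      k :* y₁ :* z₁ :+ k :* y₂ :* z₂ :+ k :* y₃ :* z₃ := k :* (y₁ :* z₁ :+ y₂ :* z₂ :+ y₃ :* z₃)) refl

  ⨯-orthogonalˡ : ∀ x y → (x ⨯ y) ∙ x ≈ 0#
  ⨯-orthogonalˡ (x₁ , x₂ , x₃) (y₁ , y₂ , y₃) =
    solve 6 (λ x₁ x₂ x₃ y₁ y₂ y₃ →
      (x₂ :* y₃ :- x₃ :* y₂) :* x₁ :+ (x₃ :* y₁ :- x₁ :* y₃) :* x₂ :+ (x₁ :* y₂ :- x₂ :* y₁) :* x₃ := con (+ 0))
      refl x₁ x₂ x₃ y₁ y₂ y₃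

  ⨯-orthogonalʳ : ∀ x y → (x ⨯ y) ∙ y ≈ 0#
  ⨯-orthogonalʳ (x₁ , x₂ , x₃) (y₁ , y₂ , y₃) =
    solve 6 (λ x₁ x₂ x₃ y₁ y₂ y₃ →
      (x₂ :* y₃ :- x₃ :* y₂) :* y₁ :+ (x₃ :* y₁ :- x₁ :* y₃) :* y₂ :+ (x₁ :* y₂ :- x₂ :* y₁) :* y₃ := con (+ 0))
      refl x₁ x₂ x₃ y₁ y₂ y₃

  -- The triple product expansion x ⨯ (y ⨯ z) = (x ∙ z) y - (x ∙ y) z, read off componentwise.
  ⨯-⨯-vanishes : ∀ x y z → x ∙ y ≈ 0# → x ∙ z ≈ 0# → IsZero³ (x ⨯ (y ⨯ z))
  ⨯-⨯-vanishes (x₁ , x₂ , x₃) (y₁ , y₂ , y₃) (z₁ , z₂ , z₃) xy≈0 xz≈0 =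
    combination≈0 (solve 9 (λ x₁ x₂ x₃ y₁ y₂ y₃ z₁ z₂ z₃ →
        x₂ :* (y₁ :* z₂ :- y₂ :* z₁) :- x₃ :* (y₃ :* z₁ :- y₁ :* z₃)
          := y₁ :* (x₁ :* z₁ :+ x₂ :* z₂ :+ x₃ :* z₃) :- z₁ :* (x₁ :* y₁ :+ x₂ :* y₂ :+ x₃ :* y₃))
        refl x₁ x₂ x₃ y₁ y₂ y₃ z₁ z₂ z₃) ,
    combination≈0 (solve 9 (λ x₁ x₂ x₃ y₁ y₂ y₃ z₁ z₂ z₃ →
        x₃ :* (y₂ :* z₃ :- y₃ :* z₂) :- x₁ :* (y₁ :* z₂ :- y₂ :* z₁)
          := y₂ :* (x₁ :* z₁ :+ x₂ :* z₂ :+ x₃ :* z₃) :- z₂ :* (x₁ :* y₁ :+ x₂ :* y₂ :+ x₃ :* y₃))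
        refl x₁ x₂ x₃ y₁ y₂ y₃ z₁ z₂ z₃) ,
    combination≈0 (solve 9 (λ x₁ x₂ x₃ y₁ y₂ y₃ z₁ z₂ z₃ →
        x₁ :* (y₃ :* z₁ :- y₁ :* z₃) :- x₂ :* (y₂ :* z₃ :- y₃ :* z₂)
          := y₃ :* (x₁ :* z₁ :+ x₂ :* z₂ :+ x₃ :* z₃) :- z₃ :* (x₁ :* y₁ :+ x₂ :* y₂ :+ x₃ :* y₃))
        refl x₁ x₂ x₃ y₁ y₂ y₃ z₁ z₂ z₃)
    where
    xy = x₁ * y₁ + x₂ * y₂ + x₃ * y₃
    xz = x₁ * z₁ + x₂ * z₂ + x₃ * z₃
    combination≈0 : ∀ {u a b} → u ≈ a * xz - b * xy → u ≈ 0#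
    combination≈0 {u} {a} {b} e = begin
      u                ≈⟨ e ⟩
      a * xz - b * xy  ≈⟨ +-cong (*-congˡ xz≈0) (-‿cong (*-congˡ xy≈0)) ⟩
      a * 0# - b * 0#  ≈⟨ +-cong (zeroʳ a) (-‿cong (zeroʳ b)) ⟩
      0# - 0#          ≈⟨ -‿inverseʳ 0# ⟩
      0#               ∎

  private
    minor≈0 : ∀ {x y x′ y′} → x * y - x′ * y′ ≈ 0# → x * y ≈ x′ * y′
    minor≈0 = x∙y⁻¹≈ε⇒x≈y _ _

    pivot : ∀ {x y x′ y′} → x ≈ 1# → x * y ≈ x′ * y′ → y ≈ y′ * x′
    pivot {x} {y} {x′} {y′} x≈1 e = begin
      y        ≈⟨ *-identityˡ y ⟨
      1# * y   ≈⟨ *-congʳ x≈1 ⟨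
      x * y    ≈⟨ e ⟩
      x′ * y′  ≈⟨ *-comm x′ y′ ⟩
      y′ * x′  ∎

  ⨯-vanishes⇒multiple : ∀ t w → Normalized t → IsZero³ (coords t ⨯ w) → ∃ λ k → w ≈³ k · coords t
  ⨯-vanishes⇒multiple t (w₁ , w₂ , w₃) (inj₁ A≈1) (c₁ , c₂ , c₃) =
    w₁ , pivot A≈1 refl , pivot A≈1 (minor≈0 c₃) , pivot A≈1 (sym (minor≈0 c₂))
  ⨯-vanishes⇒multiple t (w₁ , w₂ , w₃) (inj₂ (inj₁ (_ , B≈1))) (c₁ , c₂ , c₃) =
    w₂ , pivot B≈1 (sym (minor≈0 c₃)) , pivot B≈1 refl , pivot B≈1 (minor≈0 c₁)
  ⨯-vanishes⇒multiple t (w₁ , w₂ , w₃) (inj₂ (inj₂ (_ , _ , C≈1))) (c₁ , c₂ , c₃) =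
    w₃ , pivot C≈1 (minor≈0 c₂) , pivot C≈1 (sym (minor≈0 c₁)) , pivot C≈1 refl

  private
    scalar≈1 : ∀ {x x′ k} → x ≈ 1# → x′ ≈ 1# → x ≈ k * x′ → k ≈ 1#
    scalar≈1 {x} {x′} {k} x≈1 x′≈1 e = begin
      k       ≈⟨ *-identityʳ k ⟨
      k * 1#  ≈⟨ *-congˡ x′≈1 ⟨
      k * x′  ≈⟨ e ⟨
      x       ≈⟨ x≈1 ⟩
      1#      ∎

    later-pivot : ∀ {x x′ k} → x ≈ 1# → x′ ≈ 0# → x ≈ k * x′ → ⊥
    later-pivot {x} {x′} {k} x≈1 x′≈0 e = 0≉1 (begin
      0#      ≈⟨ zeroʳ k ⟨
      k * 0#  ≈⟨ *-congˡ x′≈0 ⟨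
      k * x′  ≈⟨ e ⟨
      x       ≈⟨ x≈1 ⟩
      1#      ∎)

    earlier-pivot : ∀ {x x′ y y′ k} → x ≈ 0# → x′ ≈ 1# → x ≈ k * x′ → y ≈ 1# → y ≈ k * y′ → ⊥
    earlier-pivot {x} {x′} {y} {y′} {k} x≈0 x′≈1 e y≈1 f = 0≉1 (begin
      0#       ≈⟨ zeroˡ y′ ⟨
      0# * y′  ≈⟨ *-congʳ k≈0 ⟨
      k * y′   ≈⟨ f ⟨
      y        ≈⟨ y≈1 ⟩
      1#       ∎)
      where
      k≈0 : k ≈ 0#
      k≈0 = begin
        k       ≈⟨ *-identityʳ k ⟨
        k * 1#  ≈⟨ *-congˡ x′≈1 ⟨
        k * x′  ≈⟨ e ⟨
        x       ≈⟨ x≈0 ⟩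
        0#      ∎

  proportional-normalized⇒scalar≈1 : ∀ {t t′ k} → Normalized t → Normalized t′ → coords t ≈³ k · coords t′ → k ≈ 1#
  proportional-normalized⇒scalar≈1 (inj₁ A≈1) (inj₁ A′≈1) (e , _) = scalar≈1 A≈1 A′≈1 e
  proportional-normalized⇒scalar≈1 (inj₁ A≈1) (inj₂ (inj₁ (A′≈0 , _))) (e , _) = ⊥-elim (later-pivot A≈1 A′≈0 e)
  proportional-normalized⇒scalar≈1 (inj₁ A≈1) (inj₂ (inj₂ (A′≈0 , _))) (e , _) = ⊥-elim (later-pivot A≈1 A′≈0 e)
  proportional-normalized⇒scalar≈1 (inj₂ (inj₁ (A≈0 , B≈1))) (inj₁ A′≈1) (e , f , _) = ⊥-elim (earlier-pivot A≈0 A′≈1 e B≈1 f)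
  proportional-normalized⇒scalar≈1 (inj₂ (inj₁ (_ , B≈1))) (inj₂ (inj₁ (_ , B′≈1))) (_ , f , _) = scalar≈1 B≈1 B′≈1 f
  proportional-normalized⇒scalar≈1 (inj₂ (inj₁ (_ , B≈1))) (inj₂ (inj₂ (_ , B′≈0 , _))) (_ , f , _) = ⊥-elim (later-pivot B≈1 B′≈0 f)
  proportional-normalized⇒scalar≈1 (inj₂ (inj₂ (A≈0 , _ , C≈1))) (inj₁ A′≈1) (e , _ , g) = ⊥-elim (earlier-pivot A≈0 A′≈1 e C≈1 g)
  proportional-normalized⇒scalar≈1 (inj₂ (inj₂ (_ , B≈0 , C≈1))) (inj₂ (inj₁ (_ , B′≈1))) (_ , f , g) = ⊥-elim (earlier-pivot B≈0 B′≈1 f C≈1 g)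
  proportional-normalized⇒scalar≈1 (inj₂ (inj₂ (_ , _ , C≈1))) (inj₂ (inj₂ (_ , _ , C′≈1))) (_ , _ , g) = scalar≈1 C≈1 C′≈1 g

  coords-injective : ∀ t t′ → coords t ≈³ coords t′ → t ≡ t′
  coords-injective (a , b , c) (a′ , b′ , c′) (e₁ , e₂ , e₃)
    with enum-inj a a′ e₁ | enum-inj b b′ e₂ | enum-inj c c′ e₃
  ... | ≡.refl | ≡.refl | ≡.refl = ≡.refl

  proportional-normalized⇒≡ : ∀ {t t′ k} → Normalized t → Normalized t′ → coords t ≈³ k · coords t′ → t ≡ t′
  proportional-normalized⇒≡ {t} {t′} nt nt′ e =
    coords-injective t t′ (≈³-trans e (·-identityˡ (coords t′) (proportional-normalized⇒scalar≈1 nt nt′ e)))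

  normalized-nonzero : ∀ t → Normalized t → ¬ IsZero³ (coords t)
  normalized-nonzero t (inj₁ A≈1) (A≈0 , _ , _) = 0≉1 (trans (sym A≈0) A≈1)
  normalized-nonzero t (inj₂ (inj₁ (_ , B≈1))) (_ , B≈0 , _) = 0≉1 (trans (sym B≈0) B≈1)
  normalized-nonzero t (inj₂ (inj₂ (_ , _ , C≈1))) (_ , _ , C≈0) = 0≉1 (trans (sym C≈0) C≈1)

  fromCoords : K³ → Triple q
  fromCoords (x₁ , x₂ , x₃) = proj₁ (enum-surj x₁) , proj₁ (enum-surj x₂) , proj₁ (enum-surj x₃)

  coords-fromCoords : ∀ x → coords (fromCoords x) ≈³ x
  coords-fromCoords (x₁ , x₂ , x₃) = proj₂ (enum-surj x₁) , proj₂ (enum-surj x₂) , proj₂ (enum-surj x₃)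

  -- The inverse of the first nonzero coordinate (0# for the zero vector, which has no point).
  leadingInverse : K³ → Carrier
  leadingInverse (x₁ , x₂ , x₃) with x₁ ≟ 0# | x₂ ≟ 0# | x₃ ≟ 0#
  ... | no x₁≉0 | _ | _ = proj₁ (inverse x₁ x₁≉0)
  ... | yes _ | no x₂≉0 | _ = proj₁ (inverse x₂ x₂≉0)
  ... | yes _ | yes _ | no x₃≉0 = proj₁ (inverse x₃ x₃≉0)
  ... | yes _ | yes _ | yes _ = 0#

  normalize : K³ → Triple q
  normalize x = fromCoords (leadingInverse x · x)

  coords-normalize : ∀ x → coords (normalize x) ≈³ leadingInverse x · x
  coords-normalize x = coords-fromCoords (leadingInverse x · x)

  private
    inverse⁻¹ : ∀ {x} (x≉0 : ¬ x ≈ 0#) → proj₁ (inverse x x≉0) * x ≈ 1#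
    inverse⁻¹ {x} x≉0 = trans (*-comm _ x) (proj₂ (inverse x x≉0))

    scaled0 : ∀ {u k x} → u ≈ k * x → x ≈ 0# → u ≈ 0#
    scaled0 {k = k} e x≈0 = trans e (trans (*-congˡ x≈0) (zeroʳ k))

  normalize-normalized : ∀ x → ¬ IsZero³ x → Normalized (normalize x)
  normalize-normalized x@(x₁ , x₂ , x₃) x≉0 with x₁ ≟ 0# | x₂ ≟ 0# | x₃ ≟ 0# | coords-normalize x
  ... | no x₁≉0 | _ | _ | (e₁ , _ , _) = inj₁ (trans e₁ (inverse⁻¹ x₁≉0))
  ... | yes x₁≈0 | no x₂≉0 | _ | (e₁ , e₂ , _) = inj₂ (inj₁ (scaled0 e₁ x₁≈0 , trans e₂ (inverse⁻¹ x₂≉0)))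
  ... | yes x₁≈0 | yes x₂≈0 | no x₃≉0 | (e₁ , e₂ , e₃) = inj₂ (inj₂ (scaled0 e₁ x₁≈0 , scaled0 e₂ x₂≈0 , trans e₃ (inverse⁻¹ x₃≉0)))
  ... | yes x₁≈0 | yes x₂≈0 | yes x₃≈0 | _ = ⊥-elim (x≉0 (x₁≈0 , x₂≈0 , x₃≈0))

  incident-sym : ∀ {p l} → Incident p l → Incident l p
  incident-sym {p} {l} e = trans (∙-comm (coords p) (coords l)) e

  join : Triple q → Triple q → Triple q
  join a b = normalize (coords a ⨯ coords b)

  ⨯-nonzero : ∀ {a b} → Normalized a → Normalized b → a ≢ b → ¬ IsZero³ (coords a ⨯ coords b)
  ⨯-nonzero {a} {b} na nb a≢b ab≈0 with ⨯-vanishes⇒multiple a (coords b) na ab≈0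
  ... | k , b≈ka = a≢b (≡.sym (proportional-normalized⇒≡ nb na b≈ka))

  join-normalized : ∀ {a b} → Normalized a → Normalized b → a ≢ b → Normalized (join a b)
  join-normalized na nb a≢b = normalize-normalized _ (⨯-nonzero na nb a≢b)

  private
    incident-join : ∀ a b {p} → (coords a ⨯ coords b) ∙ coords p ≈ 0# → Incident p (join a b)
    incident-join a b {p} e = begin
      coords (join a b) ∙ coords p                                               ≈⟨ ∙-·ˡ (coords p) (coords-normalize _) ⟩
      leadingInverse (coords a ⨯ coords b) * ((coords a ⨯ coords b) ∙ coords p)  ≈⟨ *-congˡ e ⟩
      leadingInverse (coords a ⨯ coords b) * 0#                                  ≈⟨ zeroʳ _ ⟩
      0#                                                                         ∎

  incident-join₁ : ∀ a b → Incident a (join a b)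
  incident-join₁ a b = incident-join a b (⨯-orthogonalˡ (coords a) (coords b))

  incident-join₂ : ∀ a b → Incident b (join a b)
  incident-join₂ a b = incident-join a b (⨯-orthogonalʳ (coords a) (coords b))

  join-unique : ∀ {a b t} → Normalized a → Normalized b → a ≢ b → Normalized t →
                Incident a t → Incident b t → t ≡ join a b
  join-unique {a} {b} {t} na nb a≢b nt at bt =
    ≡.sym (proportional-normalized⇒≡ {join a b} {t} {leadingInverse (coords a ⨯ coords b) * k} (join-normalized na nb a≢b) nt
      (≈³-trans (coords-normalize (coords a ⨯ coords b)) (≈³-trans (·-congˡ _ a⨯b≈kt) (·-assoc _ k (coords t)))))
    where
    multiple = ⨯-vanishes⇒multiple t (coords a ⨯ coords b) nt (⨯-⨯-vanishes (coords t) (coords a) (coords b) at bt)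
    k = proj₁ multiple
    a⨯b≈kt = proj₂ multiple

  i₀ i₁ : Fin q
  i₀ = proj₁ (enum-surj 0#)
  i₁ = proj₁ (enum-surj 1#)

  enum-i₀ : enum i₀ ≈ 0#
  enum-i₀ = proj₂ (enum-surj 0#)

  enum-i₁ : enum i₁ ≈ 1#
  enum-i₁ = proj₂ (enum-surj 1#)

  ≈0⇒≡i₀ : ∀ {a} → enum a ≈ 0# → a ≡ i₀
  ≈0⇒≡i₀ {a} e = enum-inj a i₀ (trans e (sym enum-i₀))

  ≈1⇒≡i₁ : ∀ {a} → enum a ≈ 1# → a ≡ i₁
  ≈1⇒≡i₁ {a} e = enum-inj a i₁ (trans e (sym enum-i₁))

  i₁≢i₀ : i₁ ≢ i₀
  i₁≢i₀ i₁≡i₀ = 0≉1 (trans (sym enum-i₀) (trans (reflexive (≡.cong enum (≡.sym i₁≡i₀))) enum-i₁))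

  ∞ : Triple q
  ∞ = i₀ , i₀ , i₁

  ∞-normalized : Normalized ∞
  ∞-normalized = inj₂ (inj₂ (enum-i₀ , enum-i₀ , enum-i₁))

  private
    ∞∙ : ∀ t → coords ∞ ∙ coords t ≈ enum (proj₂ (proj₂ t))
    ∞∙ t = begin
      coords ∞ ∙ coords t        ≈⟨ ∙-comm (coords ∞) (coords t) ⟩
      coords t ∙ coords ∞        ≈⟨ ∙-congʳ (coords t) (enum-i₀ , enum-i₀ , enum-i₁) ⟩
      coords t ∙ (0# , 0# , 1#)  ≈⟨ ∙-001 (coords t) ⟩
      enum (proj₂ (proj₂ t))     ∎

  incident-∞ : ∀ {x y z} → Incident (x , y , z) ∞ → enum z ≈ 0#
  incident-∞ {x} {y} {z} e = trans (sym (∞∙ (x , y , z))) e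

  ∞-incident : ∀ {x y z} → enum z ≈ 0# → Incident (x , y , z) ∞
  ∞-incident {x} {y} {z} e = trans (∞∙ (x , y , z)) e

  private
    off-∞ : ∀ {x y} → ¬ Incident (x , y , i₁) ∞
    off-∞ e = 0≉1 (trans (sym (incident-∞ e)) enum-i₁)

  -- Among (0:0:1), (1:0:1), (0:1:1), none of which is on ∞, a line can contain at most two.
  point-off-line-and-∞ : ∀ {l} → Normalized l → ∃ λ p → Normalized p × ¬ Incident p l × ¬ Incident p ∞
  point-off-line-and-∞ {l} nl with incident? (i₀ , i₀ , i₁) l | incident? (i₁ , i₀ , i₁) l | incident? (i₀ , i₁ , i₁) l
  ... | no p∉l | _ | _ = _ , inj₂ (inj₂ (enum-i₀ , enum-i₀ , enum-i₁)) , p∉l , off-∞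
  ... | yes _ | no p∉l | _ = _ , inj₁ enum-i₁ , p∉l , off-∞
  ... | yes _ | yes _ | no p∉l = _ , inj₂ (inj₁ (enum-i₀ , enum-i₁)) , p∉l , off-∞
  ... | yes e₃∈l | yes e₁₃∈l | yes e₂₃∈l = ⊥-elim (normalized-nonzero l nl (A≈0 , B≈0 , C≈0))
    where
    C≈0 = trans (sym (∙-001 (coords l))) (trans (sym (∙-congʳ (coords l) (enum-i₀ , enum-i₀ , enum-i₁))) e₃∈l)
    A+C≈0 = trans (sym (∙-101 (coords l))) (trans (sym (∙-congʳ (coords l) (enum-i₁ , enum-i₀ , enum-i₁))) e₁₃∈l)
    B+C≈0 = trans (sym (∙-011 (coords l))) (trans (sym (∙-congʳ (coords l) (enum-i₀ , enum-i₁ , enum-i₁))) e₂₃∈l)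
    A≈0 = trans (sym (+-identityʳ _)) (trans (+-congˡ (sym C≈0)) A+C≈0)
    B≈0 = trans (sym (+-identityʳ _)) (trans (+-congˡ (sym C≈0)) B+C≈0)

module Incidences {q : ℕ} (K : FiniteField q) where
  open import Data.Nat using (ℕ; suc; _+_; _*_)
  open import Data.Nat.Properties using (*-identityˡ; *-identityʳ; +-comm; +-cancelʳ-≡; *-commutativeSemigroup)
  open import Data.Nat.Tactic.RingSolver using (solve-∀)
  open import Algebra.Properties.CommutativeSemigroup *-commutativeSemigroup using (x∙yz≈y∙xz)
  open import Data.Fin as Fin using ()
  open import Data.Product using (_×_; _,_; proj₁; proj₂)
  open import Data.Product.Properties using (≡-dec)
  open import Data.Sum using (inj₁; inj₂)
  open import Data.Empty using (⊥-elim)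
  open import Data.List using (List; []; _∷_; _++_; [_]; length; filter; map; concatMap; allFin)
  open import Data.List.Properties using (length-++; length-map; length-tabulate)
  open import Data.List.Membership.Propositional using (_∈_; lose; find)
  open import Data.List.Membership.Propositional.Properties
    using (∈-filter⁺; ∈-filter⁻; ∈-map⁺; ∈-map⁻; ∈-concatMap⁺; ∈-concatMap⁻; ∈-allFin; ∈-++⁺ˡ; ∈-++⁺ʳ; ∈-++⁻)
  open import Data.List.Relation.Unary.Any using (here)
  open import Data.List.Relation.Unary.All as All using ()
  open import Data.List.Relation.Unary.AllPairs using ([]; _∷_)
  open import Data.List.Relation.Unary.Unique.Propositional.Properties using (map⁺; filter⁺; ++⁺; allFin⁺)
  open import Relation.Nullary using (¬_; Dec; yes; no)
  open import Relation.Nullary.Decidable using (_×-dec_)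
  open import Relation.Binary.Definitions using (DecidableEquality)
  open import Function using (case_of_)
  open import Relation.Binary.PropositionalEquality as ≡ using (_≡_; _≢_; refl; module ≡-Reasoning)
  open Counting
  open FiniteField K using (0≉1; trans; sym)
  open PG2 K
  open Coordinates K

  _≟ᵗ_ : DecidableEquality (Triple q)
  _≟ᵗ_ = ≡-dec Fin._≟_ (≡-dec Fin._≟_ Fin._≟_)

  open import Data.List.Membership.DecPropositional _≟ᵗ_ using (_∈?_)

  allTriples-complete : ∀ t → t ∈ allTriples q
  allTriples-complete (a , b , c) =
    ∈-concatMap⁺ _ (lose (∈-allFin a) (∈-concatMap⁺ _ (lose (∈-allFin b) (∈-map⁺ _ (∈-allFin c)))))

  allTriples-unique : Unique (allTriples q)
  allTriples-unique = Unique-concatMap proj₁ (allFin⁺ q) inner-unique outer-key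
    where
    inner-unique : ∀ a → Unique (concatMap (λ b → map (λ c → a , b , c) (allFin q)) (allFin q))
    inner-unique a = Unique-concatMap (λ t → proj₁ (proj₂ t)) (allFin⁺ q) (λ b → map⁺ (λ { refl → refl }) (allFin⁺ q)) inner-key
      where
      inner-key : ∀ {b t} → t ∈ map (λ c → a , b , c) (allFin q) → proj₁ (proj₂ t) ≡ b
      inner-key {b} t∈ with ∈-map⁻ (λ c → a , b , c) t∈
      ... | _ , _ , refl = refl
    outer-key : ∀ {a t} → t ∈ concatMap (λ b → map (λ c → a , b , c) (allFin q)) (allFin q) → proj₁ t ≡ a
    outer-key {a} t∈ with find (∈-concatMap⁻ (λ b → map (λ c → a , b , c) (allFin q)) {xs = allFin q} t∈)
    ... | b , _ , t∈′ with ∈-map⁻ (λ c → a , b , c) t∈′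
    ...   | _ , _ , refl = refl

  points : List (Triple q)
  points = filter normalized? (allTriples q)

  points-unique : Unique points
  points-unique = filter⁺ normalized? allTriples-unique

  ∈-points : ∀ {t} → Normalized t → t ∈ points
  ∈-points {t} nt = ∈-filter⁺ normalized? (allTriples-complete t) nt

  points-normalized : ∀ {t} → t ∈ points → Normalized t
  points-normalized t∈ = proj₂ (∈-filter⁻ normalized? {xs = allTriples q} t∈)

  length-filter-normalized : ∀ {P : Triple q → Set} (P? : ∀ t → Dec (P t)) →
                             length (filter (λ t → normalized? t ×-dec P? t) (allTriples q)) ≡ ∑ points (λ t → 𝟙 (P? t))
  length-filter-normalized P? = begin
    length (filter (λ t → normalized? t ×-dec P? t) (allTriples q))  ≡⟨ length-filter≡∑𝟙 _ (allTriples q) ⟩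
    ∑ (allTriples q) (λ t → 𝟙 (normalized? t ×-dec P? t))            ≡⟨ ∑-cong (allTriples q) (λ {t} _ → 𝟙-× (normalized? t) (P? t)) ⟩
    ∑ (allTriples q) (λ t → 𝟙 (normalized? t) * 𝟙 (P? t))            ≡⟨ ∑-filter normalized? (allTriples q) _ ⟨
    ∑ points (λ t → 𝟙 (P? t))                                        ∎
    where open ≡-Reasoning

  on : Triple q → Triple q → ℕ
  on p l = 𝟙 (incident? p l)

  on-sym : ∀ p l → on p l ≡ on l p
  on-sym p l = 𝟙-cong (incident? p l) (incident? l p) incident-sym incident-sym

  ∑-on-on : ∀ {p p′} → Normalized p → Normalized p′ → p ≢ p′ → ∑ points (λ l → on p l * on p′ l) ≡ 1
  ∑-on-on {p} {p′} np np′ p≢p′ = begin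
    ∑ points (λ l → on p l * on p′ l)  ≡⟨ ∑-cong points (λ {l} l∈ → on-on≡δ l (points-normalized l∈)) ⟩
    ∑ points (λ l → 𝟙 (l ≟ᵗ pp′) * 1)  ≡⟨ ∑-δ _≟ᵗ_ (λ _ → 1) points-unique (∈-points (join-normalized np np′ p≢p′)) ⟩
    1                                  ∎
    where
    open ≡-Reasoning
    pp′ = join p p′
    on-on≡δ : ∀ l → Normalized l → on p l * on p′ l ≡ 𝟙 (l ≟ᵗ pp′) * 1
    on-on≡δ l nl with incident? p l | incident? p′ l | l ≟ᵗ pp′
    ... | yes pl | yes p′l | yes _ = refl
    ... | yes pl | yes p′l | no l≢pp′ = ⊥-elim (l≢pp′ (join-unique np np′ p≢p′ nl pl p′l))
    ... | _ | no ¬p′l | yes refl = ⊥-elim (¬p′l (incident-join₂ p p′))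
    ... | no ¬pl | _ | yes refl = ⊥-elim (¬pl (incident-join₁ p p′))
    ... | yes _ | no _ | no _ = refl
    ... | no _ | _ | no _ = refl

  ∑-on-on-dual : ∀ {l l′} → Normalized l → Normalized l′ → l ≢ l′ → ∑ points (λ p → on p l * on p l′) ≡ 1
  ∑-on-on-dual {l} {l′} nl nl′ l≢l′ =
    ≡.trans (∑-cong points (λ {p} _ → ≡.cong₂ _*_ (on-sym p l) (on-sym p l′))) (∑-on-on nl nl′ l≢l′)

  perspectivity : ∀ {l p} → Normalized l → Normalized p → ¬ Incident p l →
                  ∑ points (λ x → on x l) ≡ ∑ points (on p)
  perspectivity {l} {p} nl np p∉l = begin
    ∑ points (λ x → on x l)                                       ≡⟨ ∑-cong points (λ x∈ → joined (points-normalized x∈)) ⟩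
    ∑ points (λ x → on x l * ∑ points (λ m → on p m * on x m))    ≡⟨ ∑-cong points (λ {x} _ → ∑-*ˡ points (on x l) _) ⟨
    ∑ points (λ x → ∑ points (λ m → on x l * (on p m * on x m)))  ≡⟨ ∑-swap points points _ ⟩
    ∑ points (λ m → ∑ points (λ x → on x l * (on p m * on x m)))  ≡⟨ ∑-cong points (λ {m} _ → ∑-cong points (λ {x} _ → x∙yz≈y∙xz (on x l) (on p m) (on x m))) ⟩
    ∑ points (λ m → ∑ points (λ x → on p m * (on x l * on x m)))  ≡⟨ ∑-cong points (λ {m} _ → ∑-*ˡ points (on p m) _) ⟩
    ∑ points (λ m → on p m * ∑ points (λ x → on x l * on x m))    ≡⟨ ∑-cong points (λ m∈ → meets (points-normalized m∈)) ⟩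
    ∑ points (on p)                                               ∎
    where
    open ≡-Reasoning
    joined : ∀ {x} → Normalized x → on x l ≡ on x l * ∑ points (λ m → on p m * on x m)
    joined {x} nx with incident? x l
    ... | no _ = refl
    ... | yes xl = ≡.sym (≡.trans (*-identityˡ _) (∑-on-on np nx (λ { refl → p∉l xl })))
    meets : ∀ {m} → Normalized m → on p m * ∑ points (λ x → on x l * on x m) ≡ on p m
    meets {m} nm with incident? p m
    ... | no _ = refl
    ... | yes pm = ≡.trans (*-identityˡ _) (∑-on-on-dual nl nm (λ { refl → p∉l pm }))

  private
    points-on-∞ : List (Triple q)
    points-on-∞ = map (λ b → i₁ , b , i₀) (allFin q) ++ [ i₀ , i₁ , i₀ ]

    points-on-∞-unique : Unique points-on-∞
    points-on-∞-unique = ++⁺ (map⁺ (λ { refl → refl }) (allFin⁺ q)) (All.[] ∷ []) λ where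
      (t∈ , here refl) → case ∈-map⁻ _ t∈ of λ where (_ , _ , e) → i₁≢i₀ (≡.sym (≡.cong proj₁ e))

    points-on-∞-length : length points-on-∞ ≡ suc q
    points-on-∞-length = begin
      length points-on-∞                               ≡⟨ length-++ (map (λ b → i₁ , b , i₀) (allFin q)) ⟩
      length (map (λ b → i₁ , b , i₀) (allFin q)) + 1  ≡⟨ ≡.cong (_+ 1) (length-map _ (allFin q)) ⟩
      length (allFin q) + 1                            ≡⟨ ≡.cong (_+ 1) (length-tabulate {n = q} (λ i → i)) ⟩
      q + 1                                            ≡⟨ +-comm q 1 ⟩
      suc q                                            ∎
      where open ≡-Reasoning

    ∈-points-on-∞ : ∀ {t} → t ∈ points-on-∞ → Normalized t × Incident t ∞
    ∈-points-on-∞ t∈ with ∈-++⁻ (map (λ b → i₁ , b , i₀) (allFin q)) t∈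
    ... | inj₁ t∈map with ∈-map⁻ _ t∈map
    ...   | _ , _ , refl = inj₁ enum-i₁ , ∞-incident enum-i₀
    ∈-points-on-∞ t∈ | inj₂ (here refl) = inj₂ (inj₁ (enum-i₀ , enum-i₁)) , ∞-incident enum-i₀

    on-∞⇒∈ : ∀ {t} → Normalized t → Incident t ∞ → t ∈ points-on-∞
    on-∞⇒∈ {a , b , c} (inj₁ a≈1) t∞ with ≈1⇒≡i₁ a≈1 | ≈0⇒≡i₀ (incident-∞ t∞)
    ... | refl | refl = ∈-++⁺ˡ (∈-map⁺ _ (∈-allFin b))
    on-∞⇒∈ {a , b , c} (inj₂ (inj₁ (a≈0 , b≈1))) t∞ with ≈0⇒≡i₀ a≈0 | ≈1⇒≡i₁ b≈1 | ≈0⇒≡i₀ (incident-∞ t∞)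
    ... | refl | refl | refl = ∈-++⁺ʳ _ (here refl)
    on-∞⇒∈ {a , b , c} (inj₂ (inj₂ (_ , _ , c≈1))) t∞ = ⊥-elim (0≉1 (trans (sym (incident-∞ t∞)) c≈1))

  ∑-on-∞ : ∑ points (λ x → on x ∞) ≡ suc q
  ∑-on-∞ = begin
    ∑ points (λ x → on x ∞)                    ≡⟨ ∑-cong points (λ x∈ → on≡𝟙∈ (points-normalized x∈)) ⟩
    ∑ points (λ x → 𝟙 (x ∈? points-on-∞) * 1)  ≡⟨ ∑-∈ _≟ᵗ_ (λ _ → 1) points-unique points-on-∞-unique (λ t∈ → ∈-points (proj₁ (∈-points-on-∞ t∈))) ⟩
    ∑ points-on-∞ (λ _ → 1)                    ≡⟨ ∑-const points-on-∞ 1 ⟩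
    1 * length points-on-∞                     ≡⟨ *-identityˡ _ ⟩
    length points-on-∞                         ≡⟨ points-on-∞-length ⟩
    suc q                                      ∎
    where
    open ≡-Reasoning
    on≡𝟙∈ : ∀ {x} → Normalized x → on x ∞ ≡ 𝟙 (x ∈? points-on-∞) * 1
    on≡𝟙∈ {x} nx = ≡.trans (𝟙-cong (incident? x ∞) (x ∈? points-on-∞) (on-∞⇒∈ nx) (λ x∈ → proj₂ (∈-points-on-∞ x∈)))
                           (≡.sym (*-identityʳ _))

  ∑-on-line : ∀ {l} → Normalized l → ∑ points (λ x → on x l) ≡ suc q
  ∑-on-line nl with point-off-line-and-∞ nl
  ... | p , np , p∉l , p∉∞ =
    ≡.trans (perspectivity nl np p∉l) (≡.trans (≡.sym (perspectivity ∞-normalized np p∉∞)) ∑-on-∞)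

  ∑-on-point : ∀ {p} → Normalized p → ∑ points (on p) ≡ suc q
  ∑-on-point {p} np = ≡.trans (∑-cong points (λ {l} _ → on-sym p l)) (∑-on-line np)

  ∑-on-on-δ : ∀ {p p′} → Normalized p → Normalized p′ → ∑ points (λ l → on p l * on p′ l) ≡ 1 + 𝟙 (p′ ≟ᵗ p) * q
  ∑-on-on-δ {p} {p′} np np′ with p′ ≟ᵗ p
  ... | yes refl = begin
    ∑ points (λ l → on p l * on p l)  ≡⟨ ∑-cong points (λ {l} _ → 𝟙-idem (incident? p l)) ⟩
    ∑ points (on p)                   ≡⟨ ∑-on-point np ⟩
    suc q                             ≡⟨ ≡.cong suc (*-identityˡ q) ⟨
    1 + 1 * q                         ∎
    where open ≡-Reasoning
  ... | no p′≢p = ∑-on-on np np′ (λ p≡p′ → p′≢p (≡.sym p≡p′))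

  length-points : length points ≡ q * q + q + 1
  length-points = +-cancelʳ-≡ q _ _ (begin
    length points + q                                     ≡⟨ ≡.cong (_+ q) (*-identityˡ _) ⟨
    1 * length points + q                                 ≡⟨ ≡.cong₂ _+_ (∑-const points 1) (∑-δ _≟ᵗ_ (λ _ → q) points-unique (∈-points ∞-normalized)) ⟨
    ∑ points (λ _ → 1) + ∑ points (λ x → 𝟙 (x ≟ᵗ ∞) * q)  ≡⟨ ∑-distrib-+ points _ _ ⟨
    ∑ points (λ x → 1 + 𝟙 (x ≟ᵗ ∞) * q)                   ≡⟨ ∑-cong points (λ x∈ → ∑-on-on-δ ∞-normalized (points-normalized x∈)) ⟨
    ∑ points (λ x → ∑ points (λ l → on ∞ l * on x l))     ≡⟨ ∑-swap points points _ ⟩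
    ∑ points (λ l → ∑ points (λ x → on ∞ l * on x l))     ≡⟨ ∑-cong points (λ {l} _ → ∑-*ˡ points (on ∞ l) _) ⟩
    ∑ points (λ l → on ∞ l * ∑ points (λ x → on x l))     ≡⟨ ∑-cong points (λ l∈ → ≡.cong (on ∞ _ *_) (∑-on-line (points-normalized l∈))) ⟩
    ∑ points (λ l → on ∞ l * suc q)                       ≡⟨ ∑-*ʳ points (suc q) (on ∞) ⟩
    ∑ points (on ∞) * suc q                               ≡⟨ ≡.cong (_* suc q) (∑-on-point ∞-normalized) ⟩
    suc q * suc q                                         ≡⟨ square q ⟩
    q * q + q + 1 + q                                     ∎)
    where
    open ≡-Reasoning
    square : ∀ q → suc q * suc q ≡ q * q + q + 1 + q
    square = solve-∀

module Arithmetic where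
  open import Data.Nat using (ℕ; suc; _+_; _*_; _∸_; _≤_; _<_; s≤s)
  open import Data.Nat.Properties
  open import Data.Nat.Tactic.RingSolver using (solve-∀; solve)
  open import Data.List using (_∷_; [])
  open import Data.Product using (_×_; _,_)
  open import Data.Sum using (_⊎_; inj₁; inj₂)
  open import Relation.Nullary using (¬_)
  open import Relation.Binary.PropositionalEquality using (_≡_; refl; sym; trans; subst)

  4+k*k≤5*k+4*z : ∀ {k z} → (z ≡ 1 × k ≡ 0) ⊎ (z ≡ 0 × 1 ≤ k) → k ≤ 4 → 4 + k * k ≤ 5 * k + 4 * z
  4+k*k≤5*k+4*z (inj₁ (refl , refl)) _ = ≤-refl
  4+k*k≤5*k+4*z {1} (inj₂ (refl , _)) _ = ≤-refl
  4+k*k≤5*k+4*z {2} (inj₂ (refl , _)) _ = m≤m+n 8 2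
  4+k*k≤5*k+4*z {3} (inj₂ (refl , _)) _ = m≤m+n 13 2
  4+k*k≤5*k+4*z {4} (inj₂ (refl , _)) _ = ≤-refl
  4+k*k≤5*k+4*z {suc (suc (suc (suc (suc _))))} (inj₂ (refl , _)) (s≤s (s≤s (s≤s (s≤s ()))))

  3*k+2*z≤2+k*k : ∀ {k z} → (z ≡ 1 × k ≡ 0) ⊎ (z ≡ 0 × 1 ≤ k) → 3 * k + 2 * z ≤ 2 + k * k
  3*k+2*z≤2+k*k (inj₁ (refl , refl)) = ≤-refl
  3*k+2*z≤2+k*k {1} (inj₂ (refl , _)) = ≤-refl
  3*k+2*z≤2+k*k {2} (inj₂ (refl , _)) = ≤-refl
  3*k+2*z≤2+k*k {suc (suc (suc j))} (inj₂ (refl , _)) = subst (3 * (3 + j) + 2 * 0 ≤_) (expand j) (m≤m+n _ _)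
    where
    expand : ∀ j → 3 * (3 + j) + 2 * 0 + (j * j + 3 * j + 2) ≡ 2 + (3 + j) * (3 + j)
    expand = solve-∀

  private
    ∸-by : ∀ {a b c} → a ≡ b + c → a ∸ b ≡ c
    ∸-by {b = b} {c} refl = m+n∸m≡n b c

  -- The polynomial identities below take q ≡ 16 + r (and the like) as hypotheses instead of
  -- substituting: with q := 16 + r the inequality chains would unfold into huge unary numerals.

  few-secancies-arith : ∀ {q u} → 16 ≤ q →
    4 * (q * q + q + 1) + (q + 1) * ((q + 1) + q) ≤ 5 * ((q + 1) * suc q) + 4 * u → 4 * q ∸ 17 < u
  few-secancies-arith {q} {u} 16≤q bound = ≰⇒> λ u≤4q∸17 → m+1+n≰m R {r * r + 13 * r + 19} (begin
    R + suc (r * r + 13 * r + 19)                  ≡⟨ expand q r q≡16+r ⟨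
    4 * (q * q + q + 1) + (q + 1) * ((q + 1) + q)  ≤⟨ bound ⟩
    5 * ((q + 1) * suc q) + 4 * u                  ≤⟨ +-monoʳ-≤ (5 * ((q + 1) * suc q)) (*-monoʳ-≤ 4 (u≤47+4r u≤4q∸17)) ⟩
    R                                              ∎)
    where
    open ≤-Reasoning
    r : ℕ
    r = q ∸ 16
    q≡16+r : q ≡ 16 + r
    q≡16+r = sym (m+[n∸m]≡n 16≤q)
    R : ℕ
    R = 5 * ((q + 1) * suc q) + 4 * (47 + 4 * r)
    4q : ∀ q r → q ≡ 16 + r → 4 * q ≡ 17 + (47 + 4 * r)
    4q _ r refl = solve (r ∷ [])
    u≤47+4r : u ≤ 4 * q ∸ 17 → u ≤ 47 + 4 * r
    u≤47+4r = subst (u ≤_) (∸-by {4 * q} {17} (4q q r q≡16+r))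
    expand : ∀ q r → q ≡ 16 + r →
             4 * (q * q + q + 1) + (q + 1) * ((q + 1) + q) ≡ 5 * ((q + 1) * suc q) + 4 * (47 + 4 * r) + suc (r * r + 13 * r + 19)
    expand _ r refl = solve (r ∷ [])

  long-secant-arith : ∀ {q u k} → 16 ≤ q → q ≤ k + 2 →
    3 * ((q + 1) * suc q) + 2 * u + (2 + k * k) ≤ 2 * (q * q + q + 1) + (q + 1) * ((q + 1) + q) + 3 * k →
    u < 3 * q ∸ 5
  long-secant-arith {q} {u} {k} 16≤q q≤k+2 bound = ≰⇒> impossible
    where
    r = q ∸ 16
    q≡16+r : q ≡ 16 + r
    q≡16+r = sym (m+[n∸m]≡n 16≤q)
    14+r≤k : 14 + r ≤ k
    14+r≤k = +-cancelʳ-≤ 2 (14 + r) k (subst (_≤ k + 2) (trans q≡16+r (+-comm 2 (14 + r))) q≤k+2)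
    d = k ∸ (14 + r)
    k≡14+r+d : k ≡ 14 + r + d
    k≡14+r+d = sym (m+[n∸m]≡n 14+r≤k)
    3q : ∀ q r → q ≡ 16 + r → 3 * q ≡ 5 + (43 + 3 * r)
    3q _ r refl = solve (r ∷ [])
    R = 2 * (q * q + q + 1) + (q + 1) * ((q + 1) + q) + 3 * k
    expand : ∀ q u k r d e → q ≡ 16 + r → u ≡ 43 + 3 * r + e → k ≡ 14 + r + d →
             3 * ((q + 1) * suc q) + 2 * u + (2 + k * k) ≡
             2 * (q * q + q + 1) + (q + 1) * ((q + 1) + q) + 3 * k + suc (1 + 2 * e + 2 * d * r + d * d + 25 * d)
    expand _ _ _ r d e refl refl refl = solve (r ∷ d ∷ e ∷ [])
    impossible : ¬ (3 * q ∸ 5 ≤ u)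
    impossible 3q∸5≤u = m+1+n≰m R {gap} (begin
      R + suc gap                                  ≡⟨ expand q u k r d e q≡16+r u≡43+3r+e k≡14+r+d ⟨
      3 * ((q + 1) * suc q) + 2 * u + (2 + k * k)  ≤⟨ bound ⟩
      R                                            ∎)
      where
      open ≤-Reasoning
      43+3r≤u : 43 + 3 * r ≤ u
      43+3r≤u = subst (_≤ u) (∸-by {3 * q} {5} (3q q r q≡16+r)) 3q∸5≤u
      e = u ∸ (43 + 3 * r)
      u≡43+3r+e : u ≡ 43 + 3 * r + e
      u≡43+3r+e = sym (m+[n∸m]≡n 43+3r≤u)
      gap = 1 + 2 * e + 2 * d * r + d * d + 25 * d

  medium-secant-arith : ∀ {q u k m} → 5 ≤ k → k + 2 < q → k + m ≡ suc q → m * q ≤ u + m * m → 4 * q ∸ 17 < u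
  medium-secant-arith {q} {u} {k} {m} 5≤k k+2<q k+m≡1+q bound = ≰⇒> λ u≤4q∸17 → m+1+n≰m R {a * b} (begin
    R + suc (a * b)  ≡⟨ expand q m a b q≡8+a+b m≡4+b ⟨
    m * q            ≤⟨ bound ⟩
    u + m * m        ≤⟨ +-monoˡ-≤ (m * m) (subst (u ≤_) (∸-by {4 * q} {17} (4q q a b q≡8+a+b)) u≤4q∸17) ⟩
    R                ∎)
    where
    open ≤-Reasoning
    a = k ∸ 5
    k≡5+a : k ≡ 5 + a
    k≡5+a = sym (m+[n∸m]≡n 5≤k)
    b = q ∸ suc (k + 2)
    q≡8+a+b : q ≡ 8 + a + b
    q≡8+a+b = trans (sym (m+[n∸m]≡n k+2<q)) (shift k a b k≡5+a)
      where
      shift : ∀ k a b → k ≡ 5 + a → suc (k + 2) + b ≡ 8 + a + b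
      shift _ a b refl = solve (a ∷ b ∷ [])
    m≡4+b : m ≡ 4 + b
    m≡4+b = +-cancelˡ-≡ k m (4 + b) (trans k+m≡1+q (complement q k a b q≡8+a+b k≡5+a))
      where
      complement : ∀ q k a b → q ≡ 8 + a + b → k ≡ 5 + a → suc q ≡ k + (4 + b)
      complement _ _ a b refl refl = solve (a ∷ b ∷ [])
    R = 15 + 4 * a + 4 * b + m * m
    4q : ∀ q a b → q ≡ 8 + a + b → 4 * q ≡ 17 + (15 + 4 * a + 4 * b)
    4q _ a b refl = solve (a ∷ b ∷ [])
    expand : ∀ q m a b → q ≡ 8 + a + b → m ≡ 4 + b → m * q ≡ 15 + 4 * a + 4 * b + m * m + suc (a * b)
    expand _ _ a b refl refl = solve (a ∷ b ∷ [])

module Secants {q : ℕ} (K : FiniteField q) (S : List (Triple q))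
               (S-normalized : All (PG2.Normalized K) S) (S-unique : Unique S) where
  open import Data.Nat using (ℕ; suc; _+_; _*_; _≤_; z≤n; s≤s)
  open import Data.Nat.Properties
  open import Data.Product using (_×_; _,_)
  open import Data.Sum using (_⊎_; inj₁; inj₂)
  open import Data.List using (List; length)
  open import Data.List.Membership.Propositional using (_∈_; _∉_)
  open import Data.List.Relation.Unary.All as All using (All)
  open import Data.List.Relation.Unary.Unique.Propositional using (Unique)
  open import Relation.Nullary using (¬_; Dec; yes; no; contradiction)
  open import Relation.Nullary.Decidable using (¬?)
  open import Relation.Binary.PropositionalEquality as ≡ using (_≡_; refl; module ≡-Reasoning)
  open Counting
  open Arithmetic
  open PG2 K
  open Coordinates K
  open Incidences K
  open import Data.List.Membership.DecPropositional _≟ᵗ_ using (_∈?_)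

  S-point : ∀ {p} → p ∈ S → Normalized p
  S-point = All.lookup S-normalized

  secancy : Triple q → ℕ
  secancy l = ∑ S (λ p → on p l)

  external? : ∀ l → Dec (All (λ p → ¬ Incident p l) S)
  external? l = All.all? (λ p → ¬? (incident? p l)) S

  external : Triple q → ℕ
  external l = 𝟙 (external? l)

  u₀≡∑external : u₀ S ≡ ∑ points external
  u₀≡∑external = length-filter-normalized external?

  external-or-secant : ∀ l → (external l ≡ 1 × secancy l ≡ 0) ⊎ (external l ≡ 0 × 1 ≤ secancy l)
  external-or-secant l with external? l
  ... | yes none = inj₁ (refl , ∑𝟙-none (λ p → incident? p l) none)
  ... | no ¬none = inj₂ (refl , ∑𝟙-some (λ p → incident? p l) ¬none)

  1≤external+secancy : ∀ l → 1 ≤ external l + secancy l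
  1≤external+secancy l with external-or-secant l
  ... | inj₁ (external≡1 , _) = ≡.subst (λ z → 1 ≤ z + secancy l) (≡.sym external≡1) (s≤s z≤n)
  ... | inj₂ (_ , 1≤secancy) = ≤-trans 1≤secancy (m≤n+m (secancy l) (external l))

  ∑-secancy : ∑ points secancy ≡ length S * suc q
  ∑-secancy = begin
    ∑ points (λ l → ∑ S (λ p → on p l))  ≡⟨ ∑-swap points S _ ⟩
    ∑ S (λ p → ∑ points (on p))          ≡⟨ ∑-cong S (λ p∈ → ∑-on-point (S-point p∈)) ⟩
    ∑ S (λ _ → suc q)                    ≡⟨ ∑-const S (suc q) ⟩
    suc q * length S                     ≡⟨ *-comm (suc q) (length S) ⟩
    length S * suc q                     ∎
    where open ≡-Reasoning

  ∑-secancy² : ∑ points (λ l → secancy l * secancy l) ≡ length S * (length S + q)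
  ∑-secancy² = begin
    ∑ points (λ l → secancy l * secancy l)                      ≡⟨ ∑-cong points (λ {l} _ → square l) ⟩
    ∑ points (λ l → ∑ S (λ p → ∑ S (λ p′ → on p l * on p′ l)))  ≡⟨ ∑-swap points S _ ⟩
    ∑ S (λ p → ∑ points (λ l → ∑ S (λ p′ → on p l * on p′ l)))  ≡⟨ ∑-cong S (λ _ → ∑-swap points S _) ⟩
    ∑ S (λ p → ∑ S (λ p′ → ∑ points (λ l → on p l * on p′ l)))  ≡⟨ ∑-cong S (λ p∈ → ∑-cong S (λ p′∈ → ∑-on-on-δ (S-point p∈) (S-point p′∈))) ⟩
    ∑ S (λ p → ∑ S (λ p′ → 1 + 𝟙 (p′ ≟ᵗ p) * q))                ≡⟨ ∑-cong S (λ p∈ → row p∈) ⟩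
    ∑ S (λ _ → length S + q)                                    ≡⟨ ∑-const S _ ⟩
    (length S + q) * length S                                   ≡⟨ *-comm (length S + q) (length S) ⟩
    length S * (length S + q)                                   ∎
    where
    open ≡-Reasoning
    square : ∀ l → secancy l * secancy l ≡ ∑ S (λ p → ∑ S (λ p′ → on p l * on p′ l))
    square l = ≡.trans (≡.sym (∑-*ʳ S (secancy l) (λ p → on p l))) (∑-cong S (λ {p} _ → ≡.sym (∑-*ˡ S (on p l) (λ p′ → on p′ l))))
    row : ∀ {p} → p ∈ S → ∑ S (λ p′ → 1 + 𝟙 (p′ ≟ᵗ p) * q) ≡ length S + q
    row {p} p∈ = begin
      ∑ S (λ p′ → 1 + 𝟙 (p′ ≟ᵗ p) * q)              ≡⟨ ∑-distrib-+ S _ _ ⟩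
      ∑ S (λ _ → 1) + ∑ S (λ p′ → 𝟙 (p′ ≟ᵗ p) * q)  ≡⟨ ≡.cong₂ _+_ (∑-const S 1) (∑-δ _≟ᵗ_ (λ _ → q) S-unique p∈) ⟩
      1 * length S + q                              ≡⟨ ≡.cong (_+ q) (*-identityˡ (length S)) ⟩
      length S + q                                  ∎

  private
    ∑-linear : ∀ a b → ∑ points (λ l → a * secancy l + b * external l) ≡ a * (length S * suc q) + b * u₀ S
    ∑-linear a b = begin
      ∑ points (λ l → a * secancy l + b * external l)                   ≡⟨ ∑-distrib-+ points _ _ ⟩
      ∑ points (λ l → a * secancy l) + ∑ points (λ l → b * external l)  ≡⟨ ≡.cong₂ _+_ (∑-*ˡ points a secancy) (∑-*ˡ points b external) ⟩
      a * ∑ points secancy + b * ∑ points external                      ≡⟨ ≡.cong₂ (λ s t → a * s + b * t) ∑-secancy (≡.sym u₀≡∑external) ⟩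
      a * (length S * suc q) + b * u₀ S                                 ∎
      where open ≡-Reasoning

    ∑-quadratic : ∀ c → ∑ points (λ l → c + secancy l * secancy l) ≡ c * (q * q + q + 1) + length S * (length S + q)
    ∑-quadratic c = begin
      ∑ points (λ l → c + secancy l * secancy l)                   ≡⟨ ∑-distrib-+ points _ _ ⟩
      ∑ points (λ _ → c) + ∑ points (λ l → secancy l * secancy l)  ≡⟨ ≡.cong₂ _+_ (∑-const points c) ∑-secancy² ⟩
      c * length points + length S * (length S + q)                ≡⟨ ≡.cong (λ n → c * n + length S * (length S + q)) length-points ⟩
      c * (q * q + q + 1) + length S * (length S + q)              ∎
      where open ≡-Reasoning

  bounded-secancy-bound : (∀ {l} → l ∈ points → secancy l ≤ 4) →
                          4 * (q * q + q + 1) + length S * (length S + q) ≤ 5 * (length S * suc q) + 4 * u₀ S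
  bounded-secancy-bound secancy≤4 = begin
    4 * (q * q + q + 1) + length S * (length S + q)  ≡⟨ ∑-quadratic 4 ⟨
    ∑ points (λ l → 4 + secancy l * secancy l)       ≤⟨ ∑-mono-≤ points (λ {l} l∈ → 4+k*k≤5*k+4*z (external-or-secant l) (secancy≤4 l∈)) ⟩
    ∑ points (λ l → 5 * secancy l + 4 * external l)  ≡⟨ ∑-linear 5 4 ⟩
    5 * (length S * suc q) + 4 * u₀ S                ∎
    where open ≤-Reasoning

  secant-bound : ∀ {ℓ} → ℓ ∈ points → 1 ≤ secancy ℓ →
                 3 * (length S * suc q) + 2 * u₀ S + (2 + secancy ℓ * secancy ℓ) ≤
                 2 * (q * q + q + 1) + length S * (length S + q) + 3 * secancy ℓ
  secant-bound {ℓ} ℓ∈ 1≤secancy = begin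
    3 * (length S * suc q) + 2 * u₀ S + (2 + secancy ℓ * secancy ℓ)            ≡⟨ ≡.cong (_+ (2 + secancy ℓ * secancy ℓ)) (∑-linear 3 2) ⟨
    ∑ points f + (2 + secancy ℓ * secancy ℓ)                                   ≤⟨ ∑-mono-≤-with-gap points (λ {l} _ → 3*k+2*z≤2+k*k (external-or-secant l)) ℓ∈ ⟩
    ∑ points (λ l → 2 + secancy l * secancy l) + f ℓ                           ≡⟨ ≡.cong₂ _+_ (∑-quadratic 2) (≡.cong (λ z → 3 * secancy ℓ + 2 * z) ℓ-secant) ⟩
    2 * (q * q + q + 1) + length S * (length S + q) + (3 * secancy ℓ + 2 * 0)  ≡⟨ ≡.cong (2 * (q * q + q + 1) + length S * (length S + q) +_) (+-identityʳ _) ⟩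
    2 * (q * q + q + 1) + length S * (length S + q) + 3 * secancy ℓ            ∎
    where
    open ≤-Reasoning
    f : Triple q → ℕ
    f l = 3 * secancy l + 2 * external l
    ℓ-secant : external ℓ ≡ 0
    ℓ-secant with external-or-secant ℓ
    ... | inj₁ (_ , secancy≡0) = contradiction (≡.subst (1 ≤_) secancy≡0 1≤secancy) λ ()
    ... | inj₂ (external≡0 , _) = external≡0

  module AroundLine {ℓ : Triple q} (nℓ : Normalized ℓ) where

    off : ℕ
    off = ∑ S (λ x → 𝟙 (¬? (incident? x ℓ)))

    secancy+off : secancy ℓ + off ≡ length S
    secancy+off = begin
      ∑ S (λ x → on x ℓ) + off                     ≡⟨ ∑-distrib-+ S _ _ ⟨
      ∑ S (λ x → on x ℓ + 𝟙 (¬? (incident? x ℓ)))  ≡⟨ ∑-cong S (λ {x} _ → 𝟙-¬ (incident? x ℓ)) ⟩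
      ∑ S (λ _ → 1)                                ≡⟨ ∑-const S 1 ⟩
      1 * length S                                 ≡⟨ *-identityˡ _ ⟩
      length S                                     ∎
      where open ≡-Reasoning

    uncovered : Triple q → ℕ
    uncovered p = on p ℓ * 𝟙 (¬? (p ∈? S))

    secancy+∑uncovered : secancy ℓ + ∑ points uncovered ≡ suc q
    secancy+∑uncovered = begin
      secancy ℓ + ∑ points uncovered                                   ≡⟨ ≡.cong (_+ ∑ points uncovered) covered ⟨
      ∑ points (λ p → on p ℓ * 𝟙 (p ∈? S)) + ∑ points uncovered        ≡⟨ ∑-distrib-+ points _ _ ⟨
      ∑ points (λ p → on p ℓ * 𝟙 (p ∈? S) + on p ℓ * 𝟙 (¬? (p ∈? S)))  ≡⟨ ∑-cong points (λ {p} _ → split p) ⟩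
      ∑ points (λ p → on p ℓ)                                          ≡⟨ ∑-on-line nℓ ⟩
      suc q                                                            ∎
      where
      open ≡-Reasoning
      covered : ∑ points (λ p → on p ℓ * 𝟙 (p ∈? S)) ≡ secancy ℓ
      covered = ≡.trans (∑-cong points (λ {p} _ → *-comm (on p ℓ) (𝟙 (p ∈? S))))
                        (∑-∈ _≟ᵗ_ (λ p → on p ℓ) points-unique S-unique (λ p∈ → ∈-points (S-point p∈)))
      split : ∀ p → on p ℓ * 𝟙 (p ∈? S) + on p ℓ * 𝟙 (¬? (p ∈? S)) ≡ on p ℓ
      split p = ≡.trans (≡.sym (*-distribˡ-+ (on p ℓ) _ _)) (≡.trans (≡.cong (on p ℓ *_) (𝟙-¬ (p ∈? S))) (*-identityʳ _))

    onOther : Triple q → Triple q → ℕ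
    onOther p l = 𝟙 (¬? (l ≟ᵗ ℓ)) * on p l

    ∑-on-split : ∀ {p} → Incident p ℓ → (g : Triple q → ℕ) → ∑ points (λ l → on p l * g l) ≡ ∑ points (λ l → onOther p l * g l) + g ℓ
    ∑-on-split {p} pℓ g = begin
      ∑ points (λ l → on p l * g l)                                     ≡⟨ ∑-δ-split _≟ᵗ_ (λ l → on p l * g l) points-unique (∈-points nℓ) ⟩
      ∑ points (λ l → 𝟙 (¬? (l ≟ᵗ ℓ)) * (on p l * g l)) + on p ℓ * g ℓ  ≡⟨ ≡.cong₂ _+_ (∑-cong points (λ {l} _ → *-assoc (𝟙 (¬? (l ≟ᵗ ℓ))) (on p l) (g l))) (≡.sym (≡.cong (_* g ℓ) (𝟙-yes (incident? p ℓ) pℓ))) ⟨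
      ∑ points (λ l → onOther p l * g l) + 1 * g ℓ                      ≡⟨ ≡.cong (∑ points (λ l → onOther p l * g l) +_) (*-identityˡ (g ℓ)) ⟩
      ∑ points (λ l → onOther p l * g l) + g ℓ                          ∎
      where open ≡-Reasoning

    ∑-onOther : ∀ {p} → Normalized p → Incident p ℓ → ∑ points (onOther p) ≡ q
    ∑-onOther {p} np pℓ = +-cancelʳ-≡ 1 (∑ points (onOther p)) q (begin
      ∑ points (onOther p) + 1              ≡⟨ ≡.cong (_+ 1) (∑-cong points (λ {l} _ → *-identityʳ (onOther p l))) ⟨
      ∑ points (λ l → onOther p l * 1) + 1  ≡⟨ ∑-on-split pℓ (λ _ → 1) ⟨
      ∑ points (λ l → on p l * 1)           ≡⟨ ∑-cong points (λ {l} _ → *-identityʳ (on p l)) ⟩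
      ∑ points (on p)                       ≡⟨ ∑-on-point np ⟩
      suc q                                 ≡⟨ +-comm 1 q ⟩
      q + 1                                 ∎)
      where open ≡-Reasoning

    ∑-onOther-on : ∀ {p x} → Normalized p → Incident p ℓ → p ∉ S → x ∈ S →
                 ∑ points (λ l → onOther p l * on x l) ≡ 𝟙 (¬? (incident? x ℓ))
    ∑-onOther-on {p} {x} np pℓ p∉S x∈S = +-cancelʳ-≡ (on x ℓ) (∑ points (λ l → onOther p l * on x l)) (𝟙 (¬? (incident? x ℓ))) (begin
      ∑ points (λ l → onOther p l * on x l) + on x ℓ  ≡⟨ ∑-on-split pℓ (on x) ⟨
      ∑ points (λ l → on p l * on x l)                ≡⟨ ∑-on-on np (S-point x∈S) (λ { refl → p∉S x∈S }) ⟩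
      1                                               ≡⟨ 𝟙-¬ (incident? x ℓ) ⟨
      on x ℓ + 𝟙 (¬? (incident? x ℓ))                 ≡⟨ +-comm (on x ℓ) _ ⟩
      𝟙 (¬? (incident? x ℓ)) + on x ℓ                 ∎)
      where open ≡-Reasoning

    ∑-onOther-secancy : ∀ {p} → Normalized p → Incident p ℓ → p ∉ S → ∑ points (λ l → onOther p l * secancy l) ≡ off
    ∑-onOther-secancy {p} np pℓ p∉S = begin
      ∑ points (λ l → onOther p l * ∑ S (λ x → on x l))  ≡⟨ ∑-cong points (λ {l} _ → ∑-*ˡ S (onOther p l) (λ x → on x l)) ⟨
      ∑ points (λ l → ∑ S (λ x → onOther p l * on x l))  ≡⟨ ∑-swap points S _ ⟩
      ∑ S (λ x → ∑ points (λ l → onOther p l * on x l))  ≡⟨ ∑-cong S (∑-onOther-on np pℓ p∉S) ⟩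
      off                                                ∎
      where open ≡-Reasoning

    externals-through : Triple q → ℕ
    externals-through p = ∑ points (λ l → onOther p l * external l)

    q≤externals-through+off : ∀ {p} → Normalized p → Incident p ℓ → p ∉ S → q ≤ externals-through p + off
    q≤externals-through+off {p} np pℓ p∉S = begin
      q                                                                    ≡⟨ ∑-onOther np pℓ ⟨
      ∑ points (onOther p)                                                 ≡⟨ ∑-cong points (λ {l} _ → *-identityʳ (onOther p l)) ⟨
      ∑ points (λ l → onOther p l * 1)                                     ≤⟨ ∑-mono-≤ points (λ {l} _ → *-monoʳ-≤ (onOther p l) (1≤external+secancy l)) ⟩
      ∑ points (λ l → onOther p l * (external l + secancy l))              ≡⟨ ∑-cong points (λ {l} _ → *-distribˡ-+ (onOther p l) _ _) ⟩
      ∑ points (λ l → onOther p l * external l + onOther p l * secancy l)  ≡⟨ ∑-distrib-+ points _ _ ⟩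
      externals-through p + ∑ points (λ l → onOther p l * secancy l)       ≡⟨ ≡.cong (externals-through p +_) (∑-onOther-secancy np pℓ p∉S) ⟩
      externals-through p + off                                            ∎
      where open ≤-Reasoning

    private
      ∑-uncovered-onOther≤1 : ∀ {l} → Normalized l → ∑ points (λ p → uncovered p * onOther p l) ≤ 1
      ∑-uncovered-onOther≤1 {l} nl = begin
        ∑ points (λ p → uncovered p * onOther p l)            ≤⟨ ∑-mono-≤ points (λ {p} _ → drop-∉S p) ⟩
        ∑ points (λ p → 𝟙 (¬? (l ≟ᵗ ℓ)) * (on p ℓ * on p l))  ≡⟨ ∑-*ˡ points (𝟙 (¬? (l ≟ᵗ ℓ))) _ ⟩
        𝟙 (¬? (l ≟ᵗ ℓ)) * ∑ points (λ p → on p ℓ * on p l)    ≤⟨ meets-once ⟩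
        1                                                     ∎
        where
        open ≤-Reasoning
        drop-∉S : ∀ p → uncovered p * onOther p l ≤ 𝟙 (¬? (l ≟ᵗ ℓ)) * (on p ℓ * on p l)
        drop-∉S p with incident? p ℓ | p ∈? S | l ≟ᵗ ℓ | incident? p l
        ... | yes _ | no _ | no _ | yes _ = ≤-refl
        ... | yes _ | no _ | no _ | no _ = ≤-refl
        ... | yes _ | no _ | yes _ | _ = z≤n
        ... | yes _ | yes _ | _ | _ = z≤n
        ... | no _ | _ | _ | _ = z≤n
        meets-once : 𝟙 (¬? (l ≟ᵗ ℓ)) * ∑ points (λ p → on p ℓ * on p l) ≤ 1
        meets-once with l ≟ᵗ ℓ
        ... | yes _ = z≤n
        ... | no l≢ℓ = ≤-reflexive (≡.trans (+-identityʳ _) (∑-on-on-dual nℓ nl (λ ℓ≡l → l≢ℓ (≡.sym ℓ≡l))))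

    ∑-uncovered-externals≤u₀ : ∑ points (λ p → uncovered p * externals-through p) ≤ u₀ S
    ∑-uncovered-externals≤u₀ = begin
      ∑ points (λ p → uncovered p * externals-through p)                          ≡⟨ ∑-cong points (λ {p} _ → ∑-*ˡ points (uncovered p) _) ⟨
      ∑ points (λ p → ∑ points (λ l → uncovered p * (onOther p l * external l)))  ≡⟨ ∑-swap points points _ ⟩
      ∑ points (λ l → ∑ points (λ p → uncovered p * (onOther p l * external l)))  ≡⟨ ∑-cong points (λ {l} _ → ∑-cong points (λ {p} _ → *-assoc (uncovered p) (onOther p l) (external l))) ⟨
      ∑ points (λ l → ∑ points (λ p → uncovered p * onOther p l * external l))    ≡⟨ ∑-cong points (λ {l} _ → ∑-*ʳ points (external l) _) ⟩
      ∑ points (λ l → ∑ points (λ p → uncovered p * onOther p l) * external l)    ≤⟨ ∑-mono-≤ points (λ {l} l∈ → *-monoˡ-≤ (external l) (∑-uncovered-onOther≤1 (points-normalized l∈))) ⟩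
      ∑ points (λ l → 1 * external l)                                             ≡⟨ ∑-cong points (λ {l} _ → *-identityˡ (external l)) ⟩
      ∑ points external                                                           ≡⟨ u₀≡∑external ⟨
      u₀ S                                                                        ∎
      where open ≤-Reasoning

    uncovered-bound : ∑ points uncovered * q ≤ u₀ S + ∑ points uncovered * off
    uncovered-bound = begin
      ∑ points uncovered * q                                                                   ≡⟨ ∑-*ʳ points q uncovered ⟨
      ∑ points (λ p → uncovered p * q)                                                         ≤⟨ ∑-mono-≤ points (λ p∈ → pointwise (points-normalized p∈)) ⟩
      ∑ points (λ p → uncovered p * (externals-through p + off))                               ≡⟨ ∑-cong points (λ {p} _ → *-distribˡ-+ (uncovered p) _ off) ⟩
      ∑ points (λ p → uncovered p * externals-through p + uncovered p * off)                   ≡⟨ ∑-distrib-+ points _ _ ⟩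
      ∑ points (λ p → uncovered p * externals-through p) + ∑ points (λ p → uncovered p * off)  ≤⟨ +-monoˡ-≤ _ ∑-uncovered-externals≤u₀ ⟩
      u₀ S + ∑ points (λ p → uncovered p * off)                                                ≡⟨ ≡.cong (u₀ S +_) (∑-*ʳ points off uncovered) ⟩
      u₀ S + ∑ points uncovered * off                                                          ∎
      where
      open ≤-Reasoning
      pointwise : ∀ {p} → Normalized p → uncovered p * q ≤ uncovered p * (externals-through p + off)
      pointwise {p} np with incident? p ℓ | p ∈? S
      ... | yes pℓ | no p∉S = *-monoʳ-≤ 1 (q≤externals-through+off np pℓ p∉S)
      ... | yes _ | yes _ = z≤n
      ... | no _ | _ = z≤n

open import Data.Nat using (ℕ; suc; _+_; _*_; _∸_; _≤_; _<_; _≤?_; z≤n; s≤s)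
open import Data.Nat.Properties using (≤-trans; ≤-pred; ≰⇒>; <⇒≱; +-cancelʳ-≤; +-cancelˡ-≡; +-comm)
open import Data.Product using (_×_; _,_)
open import Data.List using (List; length)
open import Data.List.Membership.Propositional using (_∈_; lose; find)
open import Data.List.Relation.Unary.All using (All)
open import Data.List.Relation.Unary.Any using (any?)
open import Data.List.Relation.Unary.Unique.Propositional using (Unique)
open import Function using (case_of_)
open import Relation.Nullary using (¬_; yes; no)
open import Relation.Binary.PropositionalEquality using (_≡_; subst; trans; sym)
open Counting using (∑)
open Arithmetic

module SecancyCases {q : ℕ} (16≤q : 16 ≤ q) (K : FiniteField q) (S : List (Triple q))
             (S-normalized : All (PG2.Normalized K) S) (S-unique : Unique S) (|S|≡q+1 : length S ≡ q + 1) where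
  open PG2 K
  open Incidences K
  open Secants K S S-normalized S-unique

  secancy≤4⇒u₀>4q∸17 : (∀ {l} → l ∈ points → secancy l ≤ 4) → 4 * q ∸ 17 < u₀ S
  secancy≤4⇒u₀>4q∸17 secancy≤4 = few-secancies-arith 16≤q
    (subst (λ n → 4 * (q * q + q + 1) + n * (n + q) ≤ 5 * (n * suc q) + 4 * u₀ S) |S|≡q+1 (bounded-secancy-bound secancy≤4))

  secancy≥q∸2⇒u₀<3q∸5 : ∀ {ℓ} → ℓ ∈ points → q ≤ secancy ℓ + 2 → u₀ S < 3 * q ∸ 5
  secancy≥q∸2⇒u₀<3q∸5 {ℓ} ℓ∈ q≤secancy+2 = long-secant-arith 16≤q q≤secancy+2
    (subst (λ n → 3 * (n * suc q) + 2 * u₀ S + (2 + secancy ℓ * secancy ℓ) ≤ 2 * (q * q + q + 1) + n * (n + q) + 3 * secancy ℓ)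
           |S|≡q+1 (secant-bound ℓ∈ 1≤secancy))
    where
    1≤secancy : 1 ≤ secancy ℓ
    1≤secancy = ≤-trans (s≤s z≤n) (+-cancelʳ-≤ 2 14 (secancy ℓ) (≤-trans 16≤q q≤secancy+2))

  5≤secancy<q∸2⇒u₀>4q∸17 : ∀ {ℓ} → ℓ ∈ points → 5 ≤ secancy ℓ → secancy ℓ + 2 < q → 4 * q ∸ 17 < u₀ S
  5≤secancy<q∸2⇒u₀>4q∸17 {ℓ} ℓ∈ 5≤secancy secancy+2<q =
    medium-secant-arith 5≤secancy secancy+2<q secancy+∑uncovered
      (subst (λ o → ∑ points uncovered * q ≤ u₀ S + ∑ points uncovered * o) off≡∑uncovered uncovered-bound)
    where
    open AroundLine (points-normalized ℓ∈)
    off≡∑uncovered : off ≡ ∑ points uncovered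
    off≡∑uncovered = +-cancelˡ-≡ (secancy ℓ) off (∑ points uncovered)
                       (trans secancy+off (trans |S|≡q+1 (trans (+-comm q 1) (sym secancy+∑uncovered))))

lemma4p19 : (q : ℕ) → 16 ≤ q → (K : FiniteField q) →
    (S : List (Triple q)) → All (PG2.IsPoint K) S → Unique S → length S ≡ q + 1 →
    ¬ ((3 * q ∸ 5 ≤ PG2.u₀ K S) × (PG2.u₀ K S ≤ 4 * q ∸ 17))
lemma4p19 q 16≤q K S S-normalized S-unique |S|≡q+1 (lower , upper) =
  case any? (λ l → 5 ≤? secancy l) points of λ where
    (no ¬long) → <⇒≱ (secancy≤4⇒u₀>4q∸17 (λ l∈ → ≤-pred (≰⇒> (λ 5≤ → ¬long (lose l∈ 5≤))))) upper
    (yes long) → let ℓ , ℓ∈ , 5≤secancy = find long in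
      case q ≤? secancy ℓ + 2 of λ where
        (yes q≤secancy+2) → <⇒≱ (secancy≥q∸2⇒u₀<3q∸5 ℓ∈ q≤secancy+2) lower
        (no q≰secancy+2) → <⇒≱ (5≤secancy<q∸2⇒u₀>4q∸17 ℓ∈ 5≤secancy (≰⇒> q≰secancy+2)) upper
  where
  open Incidences K
  open Secants K S S-normalized S-unique
  open SecancyCases 16≤q K S S-normalized S-unique |S|≡q+1
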